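{- Let $r\in\mathbb{N}$, $m_1,\ldots,m_r\in\mathbb{N}$, $m=\operatorname{lcm}[m_1,\ldots,m_r]$, and $M\in\mathbb{N}$ with $m\mid M$. Let $f_1,\ldots,f_r:\mathbb{N}\to\mathbb{C}$ be arbitrary arithmetical functions and $G=(g_1,\ldots,g_r)$ a system of polynomials with integer coefficients. Then \[ \frac{1}{\phi(M)}\sum_{\substack{k=1\\ \gcd(k,M)=1}}^{M} f_1(\gcd(g_1(k),m_1))\cdots f_r(\gcd(g_r(k),m_r)) =\sum_{d_1\mid m_1,\ldots,d_r\mid m_r}\frac{(\mu*f_1)(d_1)\cdots(\mu*f_r)(d_r)}{\phi(\operatorname{lcm}[d_1,\ldots,d_r])}\,\eta_G(d_1,\ldots,d_r); \] in particular the left-hand side does not depend on the choice of $M$.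
   Context: $\mathbb{N}=\{1,2,\ldots\}$. $\phi$ is Euler's totient function, $\mu$ the Möbius function, and $(f*g)(n)=\sum_{d\mid n}f(d)g(n/d)$ the Dirichlet convolution. For a system $G=(g_1,\ldots,g_r)$ of integer polynomials and $d_1,\ldots,d_r\in\mathbb{N}$, $\eta_G(d_1,\ldots,d_r)$ is the number of residues $x$ modulo $\operatorname{lcm}[d_1,\ldots,d_r]$ such that $g_i(x)\equiv 0\pmod{d_i}$ and $\gcd(x,d_i)=1$ for all $1\le i\le r$. -}

module Defs where

open import Algebra.Bundles using (CommutativeRing)
open import Data.Nat as ℕ using (ℕ; zero; suc; _/_)
open import Data.Nat.Divisibility using (_∣_; _∣?_)
open import Data.Nat.Properties using (_≟_)
open import Data.Nat.GCD using (gcd)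
open import Data.Nat.LCM using (lcm)
open import Data.Nat.Primality using (prime?)
open import Data.Integer as ℤ using (ℤ; +_; -[1+_]; ∣_∣)
open import Data.List as List using (List; []; _∷_; filter; length; upTo; concatMap; cartesianProduct)
open import Data.Vec as Vec using (Vec; []; _∷_)
open import Data.Vec.Relation.Unary.All as VAll using (All; all?)
open import Data.Product using (_×_; _,_; proj₁; proj₂)
open import Relation.Nullary using (Dec; yes; no; _×-dec_)

range1 : ℕ → List ℕ
range1 n = List.map suc (upTo n)

divisors : ℕ → List ℕ
divisors n = filter (λ d → d ∣? n) (range1 n)

φ : ℕ → ℕ
φ n = length (filter (λ k → gcd k n ≟ 1) (range1 n))

-- number of d with 2 ≤ d ≤ n and d² ∣ n   (n squarefree iff this is 0)
squareDivisorCount : ℕ → ℕ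
squareDivisorCount n = length (filter (λ d → (d ℕ.* d) ∣? n) (List.map (λ k → suc (suc k)) (upTo n)))

ω : ℕ → ℕ
ω n = length (filter (λ p → prime? p ×-dec (p ∣? n)) (range1 n))

negOnePow : ℕ → ℤ
negOnePow zero = + 1
negOnePow (suc k) = ℤ.- negOnePow k

μ : ℕ → ℤ
μ n with squareDivisorCount n
... | zero  = negOnePow (ω n)
... | suc _ = + 0

lcmV : ∀ {r} → Vec ℕ r → ℕ
lcmV [] = 1
lcmV (x ∷ xs) = lcm x (lcmV xs)

-- integer polynomials as coefficient lists [a₀, a₁, ..., a_k] (a₀ + a₁ x + ...)
Poly : Set
Poly = List ℤ

eval : Poly → ℤ → ℤ
eval [] x = + 0
eval (a ∷ as) x = a ℤ.+ x ℤ.* eval as x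

-- truncated natural division (only applied when the divisor is exact and nonzero)
_div_ : ℕ → ℕ → ℕ
a div zero = 0
a div (suc b) = a / suc b

EtaCond : ∀ {r} → Vec Poly r → Vec ℕ r → ℕ → Set
EtaCond G d x = All (λ gd → (proj₂ gd ∣ ∣ eval (proj₁ gd) (+ x) ∣) × (gcd x (proj₂ gd) ≡ 1)) (Vec.zip G d)
  where open import Relation.Binary.PropositionalEquality using (_≡_)

etaCond? : ∀ {r} (G : Vec Poly r) (d : Vec ℕ r) (x : ℕ) → Dec (EtaCond G d x)
etaCond? G d x = all? (λ gd → (proj₂ gd ∣? ∣ eval (proj₁ gd) (+ x) ∣) ×-dec (gcd x (proj₂ gd) ≟ 1)) (Vec.zip G d)

-- η_G(d₁,...,d_r): number of residues x mod lcm[d₁,...,d_r] (represented by 0 ≤ x < lcm)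
-- with g_i(x) ≡ 0 (mod d_i) and gcd(x,d_i)=1 for all i
η : ∀ {r} → Vec Poly r → Vec ℕ r → ℕ
η G d = length (filter (etaCond? G d) (upTo (lcmV d)))

divisorTuples : ∀ {r} → Vec ℕ r → List (Vec ℕ r)
divisorTuples [] = [] ∷ []
divisorTuples (m ∷ ms) = concatMap (λ d → List.map (d ∷_) (divisorTuples ms)) (divisors m)

-- notions valued in a commutative ring R (standing in for ℂ)
module RingDefs {c ℓ} (R : CommutativeRing c ℓ) where
  open CommutativeRing R

  _·_ : ℕ → Carrier → Carrier
  zero · x = 0#
  suc n · x = x + n · x

  fromℤ : ℤ → Carrier
  fromℤ (+ n) = n · 1#
  fromℤ -[1+ n ] = - (suc n · 1#)

  sumL : List Carrier → Carrier
  sumL = List.foldr _+_ 0#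

  prodV : ∀ {r} → Vec Carrier r → Carrier
  prodV = Vec.foldr′ _*_ 1#

  μ⋆ : (ℕ → Carrier) → ℕ → Carrier
  μ⋆ f n = sumL (List.map (λ de → fromℤ (μ (proj₁ de)) * f (proj₂ de))
                  (filter (λ de → proj₁ de ℕ.* proj₂ de ≟ n) (cartesianProduct (range1 n) (range1 n))))

  LHS : ∀ {r} → Vec ℕ r → ℕ → Vec (ℕ → Carrier) r → Vec Poly r → Carrier
  LHS m M f G = sumL (List.map
    (λ k → prodV (Vec.zipWith (λ fi gm → fi (gcd ∣ eval (proj₁ gm) (+ k) ∣ (proj₂ gm))) f (Vec.zip G m)))
    (filter (λ k → gcd k M ≟ 1) (range1 M)))

  RHS : ∀ {r} → Vec ℕ r → ℕ → Vec (ℕ → Carrier) r → Vec Poly r → Carrier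
  RHS m M f G = sumL (List.map
    (λ d → ((φ M div φ (lcmV d)) · prodV (Vec.zipWith μ⋆ f d)) * (η G d · 1#))
    (divisorTuples m))

module Submission where

-- Write L(d) = lcm(d₁, …, d_r) for a divisor tuple d (d_i ∣ m_i). The proof has
-- three ingredients, each developed in its own module below:
--  * Möbius inversion (MobiusInversion): f(gcd(v, m)) = Σ_{d ∣ m, d ∣ v} (μ * f)(d),
--    resting on Σ_{a ∣ k} μ(a) = [k = 1] and the values of μ (MobiusValues).
--  * Equidistribution of units (UnitsInResidueClasses): for L ∣ M, each unit class
--    mod L contains φ(M)/φ(L) units mod M, because multiplication by a unit of ℤ/M
--    lying over a given unit of ℤ/L permutes ℤ/M (liftUnit, inverse in Arithmetic).
--  * Polynomial congruences (PolynomialCongruence): d_i ∣ g_i(k) depends only on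
--    k mod L(d), and together with gcd(k, L(d)) = 1 it is the condition of η_G(d).
-- Expanding every factor by Möbius inversion turns the left-hand side into
-- Σ_d Π_i (μ * f_i)(d_i) · #{k ∈ (ℤ/M)ˣ : d_i ∣ g_i(k) ∀ i}, and the count equals
-- φ(M)/φ(L(d)) · η_G(d).

open import Algebra.Bundles using (CommutativeSemiring; CommutativeRing)
open import Data.Nat as ℕ using (ℕ; zero; suc; _≤_; _<_; s≤s; z≤n; _≟_; NonZero)
import Data.Nat.Properties as ℕP
open import Data.List as List using (List; []; _∷_; _++_; filter; length; upTo; concatMap)
import Data.List.Properties as ListP
open import Data.List.Relation.Unary.All as All using ([]; _∷_)
import Data.List.Relation.Unary.All.Properties as AllP
open import Data.Product using (_×_; _,_; proj₁; proj₂; Σ)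
open import Data.Empty using (⊥; ⊥-elim)
open import Data.Nat.Divisibility using (_∣_)
open import Data.Vec using (Vec)
open import Data.Vec.Relation.Unary.All using (All)
open import Relation.Nullary using (Dec; yes; no; ¬_; ¬?; _×-dec_)
open import Relation.Unary using (Decidable)
open import Relation.Binary.PropositionalEquality as ≡ using (_≡_)
open import Defs

upTo-< : ∀ n → All.All (_< n) (upTo n)
upTo-< n = AllP.applyUpTo⁺₁ (λ x → x) n (λ i<n → i<n)

range1-bounds : ∀ n → All.All (λ x → 1 ≤ x × x ≤ n) (range1 n)
range1-bounds n = AllP.map⁺ (All.map (λ x<n → s≤s z≤n , x<n) (upTo-< n))

upTo-suc : ∀ n → upTo (suc n) ≡ upTo n ++ (n ∷ [])
upTo-suc n = ≡.sym (ListP.upTo-∷ʳ n)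

range1-suc : ∀ n → range1 (suc n) ≡ range1 n ++ (suc n ∷ [])
range1-suc n = ≡.trans (≡.cong (List.map suc) (upTo-suc n)) (ListP.map-++ suc (upTo n) (n ∷ []))

module ListSums {c ℓ} (SR : CommutativeSemiring c ℓ) where
  open CommutativeSemiring SR
  open import Algebra.Properties.Semiring.Mult semiring using () renaming (_×_ to _·_)
  open import Relation.Binary.Reasoning.Setoid setoid

  infix 5 sumOver
  sumOver : ∀ {a} {A : Set a} → List A → (A → Carrier) → Carrier
  sumOver xs F = List.foldr _+_ 0# (List.map F xs)
  syntax sumOver xs (λ x → e) = ∑[ x ∈ xs ] e

  ind : ∀ {p} {Q : Set p} → Dec Q → Carrier → Carrier
  ind (yes _) x = x
  ind (no _)  x = 0#

  module _ {a} {A : Set a} where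

    sum-congᴬ : ∀ {xs : List A} {F G : A → Carrier} → All.All (λ x → F x ≈ G x) xs → sumOver xs F ≈ sumOver xs G
    sum-congᴬ []       = refl
    sum-congᴬ (p ∷ ps) = +-cong p (sum-congᴬ ps)

    sum-cong : ∀ (xs : List A) {F G : A → Carrier} → (∀ x → F x ≈ G x) → sumOver xs F ≈ sumOver xs G
    sum-cong xs h = sum-congᴬ (All.tabulate {xs = xs} (λ {x} _ → h x))

    sum-zeroᴬ : ∀ {xs : List A} {F : A → Carrier} → All.All (λ x → F x ≈ 0#) xs → sumOver xs F ≈ 0#
    sum-zeroᴬ []       = refl
    sum-zeroᴬ (p ∷ ps) = trans (+-cong p (sum-zeroᴬ ps)) (+-identityˡ _)

    sum-zero : ∀ (xs : List A) {F : A → Carrier} → (∀ x → F x ≈ 0#) → sumOver xs F ≈ 0#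
    sum-zero xs h = sum-zeroᴬ (All.tabulate {xs = xs} (λ {x} _ → h x))

    sum-++ : ∀ (xs ys : List A) (F : A → Carrier) → sumOver (xs ++ ys) F ≈ sumOver xs F + sumOver ys F
    sum-++ []       ys F = sym (+-identityˡ _)
    sum-++ (x ∷ xs) ys F = trans (+-congˡ (sum-++ xs ys F)) (sym (+-assoc _ _ _))

    sum-+ : ∀ (xs : List A) (F G : A → Carrier) → (∑[ x ∈ xs ] (F x + G x)) ≈ sumOver xs F + sumOver xs G
    sum-+ []       F G = sym (+-identityˡ _)
    sum-+ (x ∷ xs) F G = begin
      (F x + G x) + sumOver xs (λ y → F y + G y)     ≈⟨ +-congˡ (sum-+ xs F G) ⟩
      (F x + G x) + (sumOver xs F + sumOver xs G)     ≈⟨ +-assoc _ _ _ ⟩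
      F x + (G x + (sumOver xs F + sumOver xs G))     ≈⟨ +-congˡ (x+[y+z]≈y+[x+z] _ _ _) ⟩
      F x + (sumOver xs F + (G x + sumOver xs G))     ≈⟨ sym (+-assoc _ _ _) ⟩
      (F x + sumOver xs F) + (G x + sumOver xs G)     ∎
      where
      x+[y+z]≈y+[x+z] : ∀ a b c → a + (b + c) ≈ b + (a + c)
      x+[y+z]≈y+[x+z] a b c = trans (sym (+-assoc a b c)) (trans (+-congʳ (+-comm a b)) (+-assoc b a c))

    sum-*ˡ : ∀ (xs : List A) (k : Carrier) (F : A → Carrier) → k * sumOver xs F ≈ (∑[ x ∈ xs ] (k * F x))
    sum-*ˡ []       k F = zeroʳ k
    sum-*ˡ (x ∷ xs) k F = trans (distribˡ k _ _) (+-congˡ (sum-*ˡ xs k F))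

    sum-*ʳ : ∀ (xs : List A) (k : Carrier) (F : A → Carrier) → sumOver xs F * k ≈ (∑[ x ∈ xs ] (F x * k))
    sum-*ʳ []       k F = zeroˡ k
    sum-*ʳ (x ∷ xs) k F = trans (distribʳ k _ _) (+-congˡ (sum-*ʳ xs k F))

    sum-filter : ∀ {p} {Q : A → Set p} (Q? : Decidable Q) (xs : List A) (F : A → Carrier) →
                 sumOver (filter Q? xs) F ≈ (∑[ x ∈ xs ] ind (Q? x) (F x))
    sum-filter Q? []       F = refl
    sum-filter Q? (x ∷ xs) F with Q? x
    ... | yes _ = +-congˡ (sum-filter Q? xs F)
    ... | no _  = trans (sum-filter Q? xs F) (sym (+-identityˡ _))

    count-sum : ∀ {p} {Q : A → Set p} (Q? : Decidable Q) (xs : List A) →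
                length (filter Q? xs) · 1# ≈ (∑[ x ∈ xs ] ind (Q? x) 1#)
    count-sum Q? []       = refl
    count-sum Q? (x ∷ xs) with Q? x
    ... | yes _ = +-congˡ (count-sum Q? xs)
    ... | no _  = trans (count-sum Q? xs) (sym (+-identityˡ _))

    sum-map : ∀ {b} {B : Set b} (h : B → A) (ys : List B) (F : A → Carrier) →
              sumOver (List.map h ys) F ≡ (∑[ y ∈ ys ] F (h y))
    sum-map h []       F = ≡.refl
    sum-map h (y ∷ ys) F = ≡.cong (F (h y) +_) (sum-map h ys F)

    sum-concatMap : ∀ {b} {B : Set b} (g : B → List A) (ys : List B) (F : A → Carrier) →
                    sumOver (concatMap g ys) F ≈ (∑[ y ∈ ys ] sumOver (g y) F)
    sum-concatMap g []       F = refl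
    sum-concatMap g (y ∷ ys) F = trans (sum-++ (g y) (concatMap g ys) F) (+-congˡ (sum-concatMap g ys F))

  sum-swap : ∀ {a b} {A : Set a} {B : Set b} (xs : List A) (ys : List B) (F : A → B → Carrier) →
             (∑[ x ∈ xs ] sumOver ys (F x)) ≈ (∑[ y ∈ ys ] (∑[ x ∈ xs ] F x y))
  sum-swap []       ys F = sym (sum-zero ys (λ _ → refl))
  sum-swap (x ∷ xs) ys F = trans (+-congˡ (sum-swap xs ys F)) (sym (sum-+ ys (F x) _))

  sum-cartesianProduct : ∀ {a b} {A : Set a} {B : Set b} (xs : List A) (ys : List B) (F : A × B → Carrier) →
                         sumOver (List.cartesianProduct xs ys) F ≈ (∑[ x ∈ xs ] (∑[ y ∈ ys ] F (x , y)))
  sum-cartesianProduct []       ys F = refl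
  sum-cartesianProduct (x ∷ xs) ys F =
    trans (sum-++ (List.map (x ,_) ys) _ F) (+-cong (reflexive (sum-map (x ,_) ys F)) (sum-cartesianProduct xs ys F))

  ind-cong : ∀ {p} {Q : Set p} (d : Dec Q) {x y} → x ≈ y → ind d x ≈ ind d y
  ind-cong (yes _) e = e
  ind-cong (no _)  e = refl

  ind-zero : ∀ {p} {Q : Set p} (d : Dec Q) → ind d 0# ≈ 0#
  ind-zero (yes _) = refl
  ind-zero (no _)  = refl

  ind-*ˡ : ∀ {p} {Q : Set p} (d : Dec Q) x y → x * ind d y ≈ ind d (x * y)
  ind-*ˡ (yes _) x y = refl
  ind-*ˡ (no _)  x y = zeroʳ x

  ind-*ʳ : ∀ {p} {Q : Set p} (d : Dec Q) x y → ind d x * y ≈ ind d (x * y)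
  ind-*ʳ (yes _) x y = refl
  ind-*ʳ (no _)  x y = zeroˡ y

  ind-yes : ∀ {p} {Q : Set p} (d : Dec Q) → Q → ∀ x → ind d x ≈ x
  ind-yes (yes _) q x = refl
  ind-yes (no ¬q) q x = ⊥-elim (¬q q)

  ind-no : ∀ {p} {Q : Set p} (d : Dec Q) → ¬ Q → ∀ x → ind d x ≈ 0#
  ind-no (yes q) ¬q x = ⊥-elim (¬q q)
  ind-no (no _)  ¬q x = refl

  ind-⇔ : ∀ {p q} {Q : Set p} {Q′ : Set q} (d : Dec Q) (d′ : Dec Q′) → (Q → Q′) → (Q′ → Q) →
          ∀ x → ind d x ≈ ind d′ x
  ind-⇔ (yes q) d′ f g x = sym (ind-yes d′ (f q) x)
  ind-⇔ (no ¬q) d′ f g x = sym (ind-no d′ (λ q′ → ¬q (g q′)) x)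

  ind-∧ : ∀ {p q} {Q : Set p} {Q′ : Set q} (d : Dec Q) (d′ : Dec Q′) (e : Dec (Q × Q′)) x →
          ind d (ind d′ x) ≈ ind e x
  ind-∧ (yes q) (yes q′) e x = sym (ind-yes e (q , q′) x)
  ind-∧ (yes q) (no ¬q′) e x = sym (ind-no e (λ qq → ¬q′ (proj₂ qq)) x)
  ind-∧ (no ¬q) d′       e x = sym (ind-no e (λ qq → ¬q (proj₁ qq)) x)

  ind-product : ∀ {p q} {A : Set p} {B : Set q} (a : Dec A) (b : Dec B) x y → ind a x * ind b y ≈ ind (a ×-dec b) (x * y)
  ind-product a b x y = trans (ind-*ʳ a x (ind b y)) (trans (ind-cong a (ind-*ˡ b x y)) (ind-∧ a b (a ×-dec b) (x * y)))

  ind-comm : ∀ {p q} {Q : Set p} {Q′ : Set q} (d : Dec Q) (d′ : Dec Q′) x → ind d (ind d′ x) ≈ ind d′ (ind d x)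
  ind-comm (yes _) (yes _) x = refl
  ind-comm (yes _) (no _)  x = refl
  ind-comm (no _)  (yes _) x = refl
  ind-comm (no _)  (no _)  x = refl

  ind²-⇔ : ∀ {p q r s} {A : Set p} {B : Set q} {C : Set r} {D : Set s}
           (a : Dec A) (b : Dec B) (c : Dec C) (d : Dec D) →
           (A → B → C × D) → (C → D → A × B) → ∀ x → ind a (ind b x) ≈ ind c (ind d x)
  ind²-⇔ a b c d f g x = begin
    ind a (ind b x)          ≈⟨ ind-∧ a b (a ×-dec b) x ⟩
    ind (a ×-dec b) x        ≈⟨ ind-⇔ (a ×-dec b) (c ×-dec d) (λ (p , q) → f p q) (λ (p , q) → g p q) x ⟩
    ind (c ×-dec d) x        ≈⟨ ind-∧ c d (c ×-dec d) x ⟨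
    ind c (ind d x)          ∎

  sum-split : ∀ {a p} {A : Set a} {Q : A → Set p} (Q? : Decidable Q) (xs : List A) (F : A → Carrier) →
              sumOver xs F ≈ (∑[ x ∈ xs ] ind (¬? (Q? x)) (F x)) + (∑[ x ∈ xs ] ind (Q? x) (F x))
  sum-split Q? xs F = trans (sum-cong xs pointwise) (sum-+ xs _ _)
    where
    pointwise : ∀ x → F x ≈ ind (¬? (Q? x)) (F x) + ind (Q? x) (F x)
    pointwise x with Q? x
    ... | yes _ = sym (+-identityˡ (F x))
    ... | no _  = sym (+-identityʳ (F x))

  ind-sum : ∀ {a p} {A : Set a} {Q : Set p} (d : Dec Q) (xs : List A) (F : A → Carrier) →
            ind d (sumOver xs F) ≈ (∑[ x ∈ xs ] ind d (F x))
  ind-sum (yes _) xs F = refl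
  ind-sum (no _)  xs F = sym (sum-zero xs (λ _ → refl))

  sum-upTo-suc : ∀ n (F : ℕ → Carrier) → sumOver (upTo (suc n)) F ≈ sumOver (upTo n) F + F n
  sum-upTo-suc n F = begin
    sumOver (upTo (suc n)) F         ≈⟨ reflexive (≡.cong (λ l → sumOver l F) (upTo-suc n)) ⟩
    sumOver (upTo n ++ (n ∷ [])) F   ≈⟨ sum-++ (upTo n) (n ∷ []) F ⟩
    sumOver (upTo n) F + (F n + 0#)  ≈⟨ +-congˡ (+-identityʳ _) ⟩
    sumOver (upTo n) F + F n         ∎

  sum-range1-suc : ∀ n (F : ℕ → Carrier) → sumOver (range1 (suc n)) F ≈ sumOver (range1 n) F + F (suc n)
  sum-range1-suc n F = begin
    sumOver (range1 (suc n)) F                 ≈⟨ reflexive (≡.cong (λ l → sumOver l F) (range1-suc n)) ⟩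
    sumOver (range1 n ++ (suc n ∷ [])) F       ≈⟨ sum-++ (range1 n) (suc n ∷ []) F ⟩
    sumOver (range1 n) F + (F (suc n) + 0#)    ≈⟨ +-congˡ (+-identityʳ _) ⟩
    sumOver (range1 n) F + F (suc n)           ∎

  sum-delta : ∀ n y → y < n → (G : ℕ → Carrier) → (∑[ x ∈ upTo n ] ind (x ≟ y) (G x)) ≈ G y
  sum-delta (suc n) y y<n G with y ≟ n
  ... | yes ≡.refl = begin
    (∑[ x ∈ upTo (suc n) ] ind (x ≟ n) (G x))        ≈⟨ sum-upTo-suc n _ ⟩
    (∑[ x ∈ upTo n ] ind (x ≟ n) (G x)) + ind (n ≟ n) (G n)
      ≈⟨ +-cong (sum-zeroᴬ (All.map (λ {x} x<n → ind-no (x ≟ n) (λ e → ℕP.<-irrefl e x<n) (G x)) (upTo-< n)))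
                (ind-yes (n ≟ n) ≡.refl (G n)) ⟩
    0# + G n                                          ≈⟨ +-identityˡ _ ⟩
    G n                                               ∎
  ... | no y≢n = begin
    (∑[ x ∈ upTo (suc n) ] ind (x ≟ y) (G x))        ≈⟨ sum-upTo-suc n _ ⟩
    (∑[ x ∈ upTo n ] ind (x ≟ y) (G x)) + ind (n ≟ y) (G n)
      ≈⟨ +-cong (sum-delta n y (ℕP.≤∧≢⇒< (ℕP.≤-pred y<n) y≢n) G) (ind-no (n ≟ y) (λ e → y≢n (≡.sym e)) (G n)) ⟩
    G y + 0#                                          ≈⟨ +-identityʳ _ ⟩
    G y                                               ∎

  sum-delta₁ : ∀ n y → 1 ≤ y → y ≤ n → (G : ℕ → Carrier) → (∑[ x ∈ range1 n ] ind (x ≟ y) (G x)) ≈ G y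
  sum-delta₁ n (suc y) _ y<n G = begin
    (∑[ x ∈ range1 n ] ind (x ≟ suc y) (G x))      ≡⟨ sum-map suc (upTo n) _ ⟩
    (∑[ x ∈ upTo n ] ind (suc x ≟ suc y) (G (suc x))) ≈⟨ sum-cong (upTo n) (λ x → ind-⇔ (suc x ≟ suc y) (x ≟ y) ℕP.suc-injective (≡.cong suc) _) ⟩
    (∑[ x ∈ upTo n ] ind (x ≟ y) (G (suc x)))      ≈⟨ sum-delta n y y<n (λ x → G (suc x)) ⟩
    G (suc y)                                      ∎

  sum-bijection : ∀ M (π σ : ℕ → ℕ) → (∀ k → k < M → π k < M) → (∀ j → j < M → σ j < M) →
                  (∀ j → j < M → π (σ j) ≡ j) → (∀ k → k < M → σ (π k) ≡ k) →
                  (F : ℕ → Carrier) → (∑[ k ∈ upTo M ] F (π k)) ≈ sumOver (upTo M) F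
  sum-bijection M π σ π< σ< πσ σπ F = begin
    (∑[ k ∈ upTo M ] F (π k))
      ≈⟨ sum-congᴬ (All.map (λ {k} k<M → sym (sum-delta M (π k) (π< k k<M) F)) (upTo-< M)) ⟩
    (∑[ k ∈ upTo M ] (∑[ j ∈ upTo M ] ind (j ≟ π k) (F j)))  ≈⟨ sum-swap (upTo M) (upTo M) _ ⟩
    (∑[ j ∈ upTo M ] (∑[ k ∈ upTo M ] ind (j ≟ π k) (F j)))
      ≈⟨ sum-congᴬ (All.map (λ {j} j<M → sum-congᴬ (All.map (λ {k} k<M → ind-⇔ (j ≟ π k) (k ≟ σ j)
           (λ e → ≡.trans (≡.sym (σπ k k<M)) (≡.cong σ (≡.sym e)))
           (λ e → ≡.trans (≡.sym (πσ j j<M)) (≡.cong π (≡.sym e))) (F j)) (upTo-< M))) (upTo-< M)) ⟩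
    (∑[ j ∈ upTo M ] (∑[ k ∈ upTo M ] ind (k ≟ σ j) (F j)))
      ≈⟨ sum-congᴬ (All.map (λ {j} j<M → sum-delta M (σ j) (σ< j j<M) (λ _ → F j)) (upTo-< M)) ⟩
    sumOver (upTo M) F ∎

  sum-range1-truncate : ∀ d N (F : ℕ → Carrier) → d ≤ N → (∀ a → d < a → F a ≈ 0#) →
                        sumOver (range1 N) F ≈ sumOver (range1 d) F
  sum-range1-truncate d N F d≤N vanish =
    trans (reflexive (≡.cong (λ n → sumOver (range1 n) F) (≡.sym (ℕP.m∸n+n≡m d≤N)))) (extend (N ℕ.∸ d))
    where
    extend : ∀ j → sumOver (range1 (j ℕ.+ d)) F ≈ sumOver (range1 d) F
    extend zero    = refl
    extend (suc j) = begin
      sumOver (range1 (suc (j ℕ.+ d))) F             ≈⟨ sum-range1-suc (j ℕ.+ d) F ⟩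
      sumOver (range1 (j ℕ.+ d)) F + F (suc (j ℕ.+ d)) ≈⟨ +-cong (extend j) (vanish _ (s≤s (ℕP.m≤n+m d j))) ⟩
      sumOver (range1 d) F + 0#                       ≈⟨ +-identityʳ _ ⟩
      sumOver (range1 d) F                            ∎

module NatCounting where
  open import Data.Nat using (_+_)
  open import Data.Nat.Properties using (+-*-commutativeSemiring; +-cancelˡ-≡; +-comm)
  open import Algebra.Properties.Semiring.Mult (CommutativeSemiring.semiring +-*-commutativeSemiring)
    using () renaming (_×_ to _·_)
  open ListSums +-*-commutativeSemiring
  open import Relation.Binary.PropositionalEquality

  count≡sum : ∀ {a p} {A : Set a} {Q : A → Set p} (Q? : Decidable Q) xs →
              length (filter Q? xs) ≡ (∑[ x ∈ xs ] ind (Q? x) 1)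
  count≡sum Q? xs = trans (sym (·1≡ _)) (count-sum Q? xs)
    where
    ·1≡ : ∀ n → n · 1 ≡ n
    ·1≡ zero    = refl
    ·1≡ (suc n) = cong suc (·1≡ n)

  count-⇔ : ∀ {a p q} {A : Set a} {Q : A → Set p} {Q′ : A → Set q} (Q? : Decidable Q) (Q′? : Decidable Q′) →
            (∀ x → Q x → Q′ x) → (∀ x → Q′ x → Q x) → ∀ xs → length (filter Q? xs) ≡ length (filter Q′? xs)
  count-⇔ Q? Q′? f g xs =
    trans (count≡sum Q? xs) (trans (sum-cong xs (λ x → ind-⇔ (Q? x) (Q′? x) (f x) (g x) 1)) (sym (count≡sum Q′? xs)))

  sum-range1≡upTo : ∀ n (F : ℕ → ℕ) → F n ≡ F 0 → sumOver (range1 n) F ≡ sumOver (upTo n) F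
  sum-range1≡upTo n F Fn≡F0 = +-cancelˡ-≡ (F 0) _ _ (begin
    F 0 + sumOver (range1 n) F     ≡⟨ cong (λ l → F 0 + sumOver l F) (ListP.map-upTo suc n) ⟩
    sumOver (upTo (suc n)) F       ≡⟨ sum-upTo-suc n F ⟩
    sumOver (upTo n) F + F n       ≡⟨ cong (sumOver (upTo n) F +_) Fn≡F0 ⟩
    sumOver (upTo n) F + F 0       ≡⟨ +-comm _ (F 0) ⟩
    F 0 + sumOver (upTo n) F       ∎)
    where open ≡-Reasoning

module Arithmetic where
  open import Data.Nat
  open import Data.Nat.Properties
  open import Data.Nat.DivMod using (_%_; _/_; %-distribˡ-+; %-distribˡ-*; m%n%n≡m%n; m<n⇒m%n≡m;
    m∣n⇒o%n%m≡o%m; [m+kn]%n≡m%n; m≡m%n+[m/n]*n; m/n*n≡m)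
  open import Data.Nat.Divisibility
  open import Data.Nat.GCD using (gcd; gcd[m,n]∣m; gcd[m,n]∣n; gcd[m,n]≡0⇒m≡0; module Bézout)
  open import Data.Nat.LCM using (lcm; lcm-least; m∣lcm[m,n]; n∣lcm[m,n])
  open import Data.Nat.Coprimality as Coprimality using (Coprime; coprime-divisor; gcd≡1⇒coprime)
  open import Data.Nat.Primality using (Prime; euclidsLemma; prime⇒irreducible; prime⇒nonZero; ¬prime[1])
  open import Data.Nat.Primality.Factorisation using (factorise)
  open import Data.Sum using (inj₁; inj₂)
  open import Relation.Binary.PropositionalEquality
  open import Data.Nat.Tactic.RingSolver using (solve-∀)

  module Congruence (n : ℕ) .{{_ : NonZero n}} where
    infix 4 _≋_
    _≋_ : ℕ → ℕ → Set
    a ≋ b = a % n ≡ b % n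

    ≋-+ : ∀ {a a′ b b′} → a ≋ a′ → b ≋ b′ → a + b ≋ a′ + b′
    ≋-+ {a} {a′} {b} {b′} e f =
      trans (%-distribˡ-+ a b n) (trans (cong₂ (λ x y → (x + y) % n) e f) (sym (%-distribˡ-+ a′ b′ n)))

    ≋-* : ∀ {a a′ b b′} → a ≋ a′ → b ≋ b′ → a * b ≋ a′ * b′
    ≋-* {a} {a′} {b} {b′} e f =
      trans (%-distribˡ-* a b n) (trans (cong₂ (λ x y → (x * y) % n) e f) (sym (%-distribˡ-* a′ b′ n)))

    %-≋ : ∀ a → a % n ≋ a
    %-≋ a = m%n%n≡m%n a n

    ≋⇒≡ : ∀ {a b} → a < n → b < n → a ≋ b → a ≡ b
    ≋⇒≡ a<n b<n e = trans (sym (m<n⇒m%n≡m a<n)) (trans e (m<n⇒m%n≡m b<n))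

  ≋-descend : ∀ L M .{{_ : NonZero L}} .{{_ : NonZero M}} → L ∣ M → ∀ {a b} → a % M ≡ b % M → a % L ≡ b % L
  ≋-descend L M L∣M {a} {b} e = trans (sym (m∣n⇒o%n%m≡o%m L M a L∣M)) (trans (cong (_% L) e) (m∣n⇒o%n%m≡o%m L M b L∣M))

  coprime-* : ∀ {a b m} → Coprime a m → Coprime b m → Coprime (a * b) m
  coprime-* {a} {b} {m} ca cb {i} (i∣ab , i∣m) = cb (coprime-divisor i⊥a i∣ab , i∣m)
    where
    i⊥a : Coprime i a
    i⊥a (j∣i , j∣a) = ca (j∣a , ∣-trans j∣i i∣m)

  coprime-*⁻ : ∀ {a b m} → Coprime (a * b) m → Coprime b m
  coprime-*⁻ {a} c (i∣b , i∣m) = c (∣n⇒∣m*n a i∣b , i∣m)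

  coprime-∣ʳ : ∀ {a m m′} → m′ ∣ m → Coprime a m → Coprime a m′
  coprime-∣ʳ d c (i∣a , i∣m′) = c (i∣a , ∣-trans i∣m′ d)

  coprime-% : ∀ {a m} .{{_ : NonZero m}} → Coprime a m → Coprime (a % m) m
  coprime-% c (i∣r , i∣m) = c (∣n∣m%n⇒∣m i∣m i∣r , i∣m)

  coprime-%⁻ : ∀ {a m} .{{_ : NonZero m}} → Coprime (a % m) m → Coprime a m
  coprime-%⁻ {a} {m} c {i} (i∣a , i∣m) = c (i∣r , i∣m)
    where
    i∣r : i ∣ a % m
    i∣r = ∣m+n∣m⇒∣n (subst (i ∣_) (trans (m≡m%n+[m/n]*n a m) (+-comm (a % m) _)) i∣a) (∣n⇒∣m*n (a / m) i∣m)

  coprime-lcm : ∀ {x a b} → Coprime x a → Coprime x b → Coprime x (lcm a b)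
  coprime-lcm {x} {a} {b} ca cb =
    coprime-∣ʳ (lcm-least {a} {b} (m∣m*n b) (n∣m*n a)) (Coprimality.sym (coprime-* (Coprimality.sym ca) (Coprimality.sym cb)))

  coprime-lcm⁻ˡ : ∀ {x a b} → Coprime x (lcm a b) → Coprime x a
  coprime-lcm⁻ˡ {a = a} {b} = coprime-∣ʳ (m∣lcm[m,n] a b)

  coprime-lcm⁻ʳ : ∀ {x a b} → Coprime x (lcm a b) → Coprime x b
  coprime-lcm⁻ʳ {a = a} {b} = coprime-∣ʳ (n∣lcm[m,n] a b)

  prime≢1 : ∀ {p} → Prime p → p ≢ 1
  prime≢1 pp refl = ¬prime[1] pp

  prime≥1 : ∀ {p} → Prime p → 1 ≤ p
  prime≥1 pp = >-nonZero⁻¹ _ {{prime⇒nonZero pp}}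

  ≢0,1⇒≥2 : ∀ g → g ≢ 0 → g ≢ 1 → 2 ≤ g
  ≢0,1⇒≥2 zero          g≢0 _   = ⊥-elim (g≢0 refl)
  ≢0,1⇒≥2 (suc zero)    _   g≢1 = ⊥-elim (g≢1 refl)
  ≢0,1⇒≥2 (suc (suc _)) _   _   = s≤s (s≤s z≤n)

  primeFactor : ∀ n → 2 ≤ n → Σ ℕ (λ p → Prime p × p ∣ n)
  primeFactor n@(suc _) 2≤n with factorise n
  ... | record { factors = []    ; isFactorisation = eq ; factorsPrime = [] }     = ⊥-elim (<⇒≢ 2≤n (sym eq))
  ... | record { factors = p ∷ _ ; isFactorisation = eq ; factorsPrime = pp ∷ _ } = p , pp , subst (p ∣_) (sym eq) (m∣m*n _)

  prime∤⇒coprime : ∀ {p b} → Prime p → ¬ p ∣ b → Coprime p b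
  prime∤⇒coprime pp p∤b (i∣p , i∣b) with prime⇒irreducible pp i∣p
  ... | inj₁ i≡1 = i≡1
  ... | inj₂ refl = ⊥-elim (p∤b i∣b)

  noCommonPrime⇒coprime : ∀ {a b} → 1 ≤ b → (∀ {p} → Prime p → p ∣ a → p ∣ b → ⊥) → Coprime a b
  noCommonPrime⇒coprime {a} {b} 1≤b noPrime {i} (i∣a , i∣b) with i ≟ 1
  ... | yes i≡1 = i≡1
  ... | no  i≢1 = ⊥-elim (noPrime pp (∣-trans p∣i i∣a) (∣-trans p∣i i∣b))
    where
    i≢0 : i ≢ 0
    i≢0 refl = <⇒≢ 1≤b (sym (0∣⇒≡0 i∣b))
    factor = primeFactor i (≢0,1⇒≥2 i i≢0 i≢1)
    pp = proj₁ (proj₂ factor)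
    p∣i = proj₂ (proj₂ factor)

  -- The part of c coprime to z: repeatedly divide c by gcd(c, z), using at most
  -- f steps. It keeps every prime factor of c not dividing z, and (with enough
  -- fuel, f ≥ c) it is coprime to z.
  coprimePart : (z f c : ℕ) → ℕ
  coprimePart z zero    c = c
  coprimePart z (suc f) c with gcd c z ≟ 1
  ... | yes _ = c
  ... | no  _ = coprimePart z f (c div gcd c z)

  div-cancel : ∀ c g → g ∣ c → c ≡ (c div g) * g
  div-cancel c zero    (divides q e) = trans e (*-zeroʳ q)
  div-cancel c (suc g) g∣c           = sym (m/n*n≡m g∣c)

  coprimePart-keeps : ∀ z f c {p} → Prime p → ¬ p ∣ z → p ∣ c → p ∣ coprimePart z f c
  coprimePart-keeps z zero    c pp p∤z p∣c = p∣c
  coprimePart-keeps z (suc f) c {p} pp p∤z p∣c with gcd c z ≟ 1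
  ... | yes _ = p∣c
  ... | no  _ = coprimePart-keeps z f (c div g) pp p∤z p∣c/g
    where
    g = gcd c z
    p∣c/g : p ∣ c div g
    p∣c/g with euclidsLemma (c div g) g pp (subst (_ ∣_) (div-cancel c g (gcd[m,n]∣m c z)) p∣c)
    ... | inj₁ p∣c/g = p∣c/g
    ... | inj₂ p∣g   = ⊥-elim (p∤z (∣-trans p∣g (gcd[m,n]∣n c z)))

  coprimePart-coprime : ∀ z f c → c ≤ f → 1 ≤ c → Coprime (coprimePart z f c) z
  coprimePart-coprime z zero    c c≤f 1≤c = ⊥-elim (<⇒≱ 1≤c c≤f)
  coprimePart-coprime z (suc f) c c≤f 1≤c with gcd c z ≟ 1
  ... | yes g≡1 = gcd≡1⇒coprime g≡1
  ... | no  g≢1 = coprimePart-coprime z f c′ (≤-pred (≤-trans c′<c c≤f)) 1≤c′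
    where
    g  = gcd c z
    c′ = c div g
    c≡c′g : c ≡ c′ * g
    c≡c′g = div-cancel c g (gcd[m,n]∣m c z)
    2≤g : 2 ≤ g
    2≤g = ≢0,1⇒≥2 g (λ g≡0 → <⇒≢ 1≤c (sym (gcd[m,n]≡0⇒m≡0 g≡0))) g≢1
    1≤c′ : 1 ≤ c′
    1≤c′ with c′ | c≡c′g
    ... | zero  | c≡0 = ⊥-elim (<⇒≢ 1≤c (sym c≡0))
    ... | suc _ | _   = s≤s z≤n
    c′<c : c′ < c
    c′<c = subst (c′ <_) (sym c≡c′g) (m<m*n c′ g {{>-nonZero 1≤c′}} 2≤g)

  -- Every residue y coprime to L lifts to a u ≡ y (mod L) coprime to M, when L ∣ M:
  -- take u = y + t·L, where t is the part of M coprime to y.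
  liftUnit : ∀ L M .{{_ : NonZero L}} → 1 ≤ M → L ∣ M → ∀ y → Coprime y L →
             Σ ℕ (λ u → u % L ≡ y % L × Coprime u M)
  liftUnit L M 1≤M L∣M y y⊥L = u , [m+kn]%n≡m%n y t L , noCommonPrime⇒coprime 1≤M noCommonPrime
    where
    t = coprimePart y M M
    u = y + t * L
    t⊥y : Coprime t y
    t⊥y = coprimePart-coprime y M M ≤-refl 1≤M
    noCommonPrime : ∀ {p} → Prime p → p ∣ u → p ∣ M → ⊥
    noCommonPrime {p} pp p∣u p∣M with p ∣? y
    ... | yes p∣y with euclidsLemma t L pp (∣m+n∣m⇒∣n p∣u p∣y)
    ...   | inj₁ p∣t = prime≢1 pp (t⊥y (p∣t , p∣y))
    ...   | inj₂ p∣L = prime≢1 pp (y⊥L (p∣y , p∣L))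
    noCommonPrime {p} pp p∣u p∣M | no p∤y =
      p∤y (∣m+n∣m⇒∣n (subst (p ∣_) (+-comm y (t * L)) p∣u) (∣m⇒∣m*n L (coprimePart-keeps y M M pp p∤y p∣M)))

  inverse : ∀ M .{{_ : NonZero M}} u → Coprime u M → Σ ℕ (λ v → (v * u) % M ≡ 1 % M)
  inverse M u c with Coprimality.coprime-Bézout c
  ... | Bézout.+- x y eq = x , trans (sym (cong (_% M) eq)) ([m+kn]%n≡m%n 1 y M)
  ... | Bézout.-+ x y eq = x * t , xt·u≋1
    where
    open Congruence M
    open ≡-Reasoning
    t = x * u
    -- 1 + t = y·M ≡ 0, hence t ≡ -1 and the inverse of u is x·t
    1+t≋0 : 1 + t ≋ 0
    1+t≋0 = trans (cong (_% M) eq) (trans (n∣m⇒m%n≡0 _ M (n∣m*n y)) (sym (n∣m⇒m%n≡0 0 M (M ∣0))))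
    regroup : ∀ x u → x * (x * u) * u ≡ (x * u) * (x * u)
    regroup = solve-∀
    expand : ∀ t → t * t + (1 + t) ≡ 1 + t * (1 + t)
    expand = solve-∀
    xt·u≋1 : x * t * u ≋ 1
    xt·u≋1 = begin
      (x * t * u) % M        ≡⟨ cong (_% M) (trans (regroup x u) (sym (+-identityʳ (t * t)))) ⟩
      (t * t + 0) % M        ≡⟨ ≋-+ {t * t} {t * t} refl (sym 1+t≋0) ⟩
      (t * t + (1 + t)) % M  ≡⟨ cong (_% M) (expand t) ⟩
      (1 + t * (1 + t)) % M  ≡⟨ ≋-+ {1} {1} refl (≋-* {t} {t} refl 1+t≋0) ⟩
      (1 + t * 0) % M        ≡⟨ cong (λ w → (1 + w) % M) (*-zeroʳ t) ⟩
      1 % M                  ∎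

-- For L ∣ M, multiplication by a unit of ℤ/M lying
-- over a unit y of ℤ/L permutes the units of ℤ/M and moves the class of 1 mod L
-- onto the class of y. Hence every unit class mod L contains the same number
-- N₀ = φ(M)/φ(L) of units mod M, and for any L-periodic condition C
--   #{1 ≤ k ≤ M : gcd(k, M) = 1, C k} = φ(M)/φ(L) · #{0 ≤ x < L : C x, gcd(x, L) = 1}.
module UnitsInResidueClasses where
  open import Data.Nat
  open import Data.Nat.Properties
  open import Data.Nat.DivMod using (_%_; _/_; m%n<n; m<n⇒m%n≡m; m*n/n≡m; m∣n⇒o%n%m≡o%m)
  open import Data.Nat.Divisibility using (_∣_; ∣-refl; ∣-antisym; n∣m⇒m%n≡0)
  open import Data.Nat.GCD using (gcd; gcd-greatest; gcd[m,n]∣m; gcd-identityˡ; gcd-zeroˡ)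
  open import Data.Nat.Coprimality using (Coprime; coprime⇒gcd≡1; gcd≡1⇒coprime)
  open import Data.Unit using (tt)
  open import Relation.Binary.PropositionalEquality
  open import Data.Nat.Tactic.RingSolver using (solve-∀)
  open Arithmetic
  open ListSums +-*-commutativeSemiring
  open NatCounting

  gcd[n,n]≡n : ∀ n → gcd n n ≡ n
  gcd[n,n]≡n n = ∣-antisym (gcd[m,n]∣m n n) (gcd-greatest ∣-refl ∣-refl)

  φ≡unitCount : ∀ L → φ L ≡ (∑[ x ∈ upTo L ] ind (gcd x L ≟ 1) 1)
  φ≡unitCount L = trans (count≡sum (λ k → gcd k L ≟ 1) (range1 L))
    (sum-range1≡upTo L _ (ind-⇔ (gcd L L ≟ 1) (gcd 0 L ≟ 1) (trans (sym endpoint)) (trans endpoint) 1))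
    where
    endpoint : gcd L L ≡ gcd 0 L
    endpoint = trans (gcd[n,n]≡n L) (sym (gcd-identityˡ L))

  -- 1 is a unit, so φ(n) ≥ 1
  φ≥1 : ∀ n .{{_ : NonZero n}} → 1 ≤ φ n
  φ≥1 (suc n) = firstCounts (λ k → gcd k (suc n) ≟ 1) (gcd-zeroˡ (suc n))
    where
    firstCounts : ∀ {p} {Q : ℕ → Set p} (Q? : Decidable Q) {xs} → Q 1 → 1 ≤ length (filter Q? (1 ∷ xs))
    firstCounts Q? q with Q? 1
    ... | yes _ = s≤s z≤n
    ... | no ¬q = ⊥-elim (¬q q)

  *-div : ∀ b a → 1 ≤ b → (b * a) div b ≡ a
  *-div (suc b) a _ = trans (cong (_/ suc b) (*-comm (suc b) a)) (m*n/n≡m a (suc b))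

  module _ (M L : ℕ) .{{_ : NonZero M}} .{{_ : NonZero L}} (L∣M : L ∣ M) where

    isUnit? : ∀ k → Dec (gcd k M ≡ 1)
    isUnit? k = gcd k M ≟ 1

    isUnitL? : ∀ x → Dec (gcd x L ≡ 1)
    isUnitL? x = gcd x L ≟ 1

    classSize : ℕ → ℕ
    classSize y = ∑[ k ∈ upTo M ] ind (isUnit? k) (ind (k % L ≟ y) 1)

    N₀ : ℕ
    N₀ = classSize (1 % L)

    unit-reduces : ∀ {k} → gcd k M ≡ 1 → gcd (k % L) L ≡ 1
    unit-reduces k⊥M = coprime⇒gcd≡1 (coprime-% (coprime-∣ʳ L∣M (gcd≡1⇒coprime k⊥M)))

    %L-of-%M : ∀ a → (a % M) % L ≡ a % L
    %L-of-%M a = m∣n⇒o%n%m≡o%m L M a L∣M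

    module UnitMultiplication (u v : ℕ) (u⊥M : Coprime u M) (vu≋1 : (v * u) % M ≡ 1 % M) where
      open ≡-Reasoning
      module ≋M = Congruence M
      module ≋L = Congruence L

      π σ : ℕ → ℕ
      π k = (u * k) % M
      σ j = (v * j) % M

      cancel : ∀ a b j → j < M → (b * a) % M ≡ 1 % M → (a * ((b * j) % M)) % M ≡ j
      cancel a b j j<M ba≋1 = ≋M.≋⇒≡ (m%n<n _ M) j<M (begin
        ((a * ((b * j) % M)) % M) % M ≡⟨ ≋M.%-≋ (a * ((b * j) % M)) ⟩
        (a * ((b * j) % M)) % M       ≡⟨ ≋M.≋-* {a} {a} refl (≋M.%-≋ (b * j)) ⟩
        (a * (b * j)) % M             ≡⟨ cong (_% M) (regroup a b j) ⟩
        ((b * a) * j) % M             ≡⟨ ≋M.≋-* {b * a} {1} ba≋1 refl ⟩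
        (1 * j) % M                   ≡⟨ cong (_% M) (*-identityˡ j) ⟩
        j % M                         ∎)
        where
        regroup : ∀ a b j → a * (b * j) ≡ (b * a) * j
        regroup = solve-∀

      πσ : ∀ j → j < M → π (σ j) ≡ j
      πσ j j<M = cancel u v j j<M vu≋1

      σπ : ∀ k → k < M → σ (π k) ≡ k
      σπ k k<M = cancel v u k k<M (trans (cong (_% M) (*-comm u v)) vu≋1)

      module _ (y : ℕ) (y<L : y < L) (u≋y : u % L ≡ y % L) where
        y%L≡y : y % L ≡ y
        y%L≡y = m<n⇒m%n≡m y<L

        vu≋1[L] : (v * u) % L ≡ 1 % L
        vu≋1[L] = ≋-descend L M L∣M vu≋1

        π-reflects : ∀ k → gcd (π k) M ≡ 1 → π k % L ≡ y → gcd k M ≡ 1 × k % L ≡ 1 % L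
        π-reflects k πk⊥M πk≡y = coprime⇒gcd≡1 (coprime-*⁻ {u} (coprime-%⁻ (gcd≡1⇒coprime πk⊥M))) , (begin
          k % L               ≡⟨ cong (_% L) (sym (*-identityˡ k)) ⟩
          (1 * k) % L         ≡⟨ ≋L.≋-* {1} {v * u} (sym vu≋1[L]) refl ⟩
          (v * u * k) % L     ≡⟨ cong (_% L) (*-assoc v u k) ⟩
          (v * (u * k)) % L   ≡⟨ ≋L.≋-* {v} {v} refl (trans (sym (%L-of-%M (u * k))) (trans πk≡y (sym y%L≡y))) ⟩
          (v * y) % L         ≡⟨ ≋L.≋-* {v} {v} refl (sym u≋y) ⟩
          (v * u) % L         ≡⟨ vu≋1[L] ⟩
          1 % L               ∎)

        π-preserves : ∀ k → gcd k M ≡ 1 → k % L ≡ 1 % L → gcd (π k) M ≡ 1 × π k % L ≡ y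
        π-preserves k k⊥M k≡1 = coprime⇒gcd≡1 (coprime-% (coprime-* u⊥M (gcd≡1⇒coprime k⊥M))) , (begin
          π k % L        ≡⟨ %L-of-%M (u * k) ⟩
          (u * k) % L    ≡⟨ ≋L.≋-* {u} {y} u≋y k≡1 ⟩
          (y * 1) % L    ≡⟨ cong (_% L) (*-identityʳ y) ⟩
          y % L          ≡⟨ y%L≡y ⟩
          y              ∎)

    -- every unit class y mod L has as many units mod M as the class of 1: multiply
    -- by a unit u ≡ y (mod L) of ℤ/M
    classSize-unit : ∀ y → y < L → gcd y L ≡ 1 → classSize y ≡ N₀
    classSize-unit y y<L y⊥L = begin
      classSize y
        ≡⟨ sum-bijection M π σ (λ k _ → m%n<n (u * k) M) (λ j _ → m%n<n (v * j) M) πσ σπ (λ k → ind (isUnit? k) (ind (k % L ≟ y) 1)) ⟨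
      (∑[ k ∈ upTo M ] ind (isUnit? (π k)) (ind (π k % L ≟ y) 1))
        ≡⟨ sum-cong (upTo M) (λ k → ind²-⇔ (isUnit? (π k)) (π k % L ≟ y) (isUnit? k) (k % L ≟ 1 % L)
             (π-reflects y y<L u≋y k) (π-preserves y y<L u≋y k) 1) ⟩
      N₀ ∎
      where
      open ≡-Reasoning
      lifted = liftUnit L M (>-nonZero⁻¹ M) L∣M y (gcd≡1⇒coprime y⊥L)
      u = proj₁ lifted
      u≋y = proj₁ (proj₂ lifted)
      u⊥M = proj₂ (proj₂ lifted)
      v = proj₁ (inverse M u u⊥M)
      open UnitMultiplication u v u⊥M (proj₂ (inverse M u u⊥M))

    classSize-nonunit : ∀ x → gcd x L ≢ 1 → classSize x ≡ 0
    classSize-nonunit x x̸⊥L = sum-zero (upTo M) (λ k → trans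
      (ind-∧ (isUnit? k) (k % L ≟ x) (isUnit? k ×-dec (k % L ≟ x)) 1)
      (ind-no (isUnit? k ×-dec (k % L ≟ x)) (λ (k⊥M , k≡x) → x̸⊥L (subst (λ z → gcd z L ≡ 1) k≡x (unit-reduces k⊥M))) 1))

    classSize-ind : ∀ x → x < L → classSize x ≡ ind (isUnitL? x) N₀
    classSize-ind x x<L with isUnitL? x
    ... | yes x⊥L = classSize-unit x x<L x⊥L
    ... | no  x̸⊥L = classSize-nonunit x x̸⊥L

    sumByClass : ∀ {q} {Q : ℕ → Set q} (Q? : Decidable Q) →
                 (∑[ k ∈ upTo M ] ind (isUnit? k) (ind (Q? (k % L)) 1)) ≡ (∑[ x ∈ upTo L ] ind (Q? x) (classSize x))
    sumByClass Q? = sym (begin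
      (∑[ x ∈ upTo L ] ind (Q? x) (classSize x))
        ≡⟨ sum-cong (upTo L) (λ x → ind-sum (Q? x) (upTo M) _) ⟩
      (∑[ x ∈ upTo L ] (∑[ k ∈ upTo M ] ind (Q? x) (ind (isUnit? k) (ind (k % L ≟ x) 1))))
        ≡⟨ sum-swap (upTo L) (upTo M) _ ⟩
      (∑[ k ∈ upTo M ] (∑[ x ∈ upTo L ] ind (Q? x) (ind (isUnit? k) (ind (k % L ≟ x) 1))))
        ≡⟨ sum-cong (upTo M) (λ k → sum-cong (upTo L) (λ x → reorder k x)) ⟩
      (∑[ k ∈ upTo M ] (∑[ x ∈ upTo L ] ind (isUnit? k) (ind (x ≟ k % L) (ind (Q? x) 1))))
        ≡⟨ sum-cong (upTo M) (λ k → sym (ind-sum (isUnit? k) (upTo L) _)) ⟩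
      (∑[ k ∈ upTo M ] ind (isUnit? k) (∑[ x ∈ upTo L ] ind (x ≟ k % L) (ind (Q? x) 1)))
        ≡⟨ sum-cong (upTo M) (λ k → cong (ind (isUnit? k)) (sum-delta L (k % L) (m%n<n k L) (λ x → ind (Q? x) 1))) ⟩
      (∑[ k ∈ upTo M ] ind (isUnit? k) (ind (Q? (k % L)) 1)) ∎)
      where
      open ≡-Reasoning
      reorder : ∀ k x → ind (Q? x) (ind (isUnit? k) (ind (k % L ≟ x) 1)) ≡ ind (isUnit? k) (ind (x ≟ k % L) (ind (Q? x) 1))
      reorder k x = trans (ind-comm (Q? x) (isUnit? k) _) (cong (ind (isUnit? k))
        (trans (ind-comm (Q? x) (k % L ≟ x) 1) (ind-⇔ (k % L ≟ x) (x ≟ k % L) sym sym _)))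

    countInClasses : ∀ {q} {Q : ℕ → Set q} (Q? : Decidable Q) →
                     (∑[ k ∈ upTo M ] ind (isUnit? k) (ind (Q? (k % L)) 1))
                       ≡ (∑[ x ∈ upTo L ] ind (Q? x) (ind (isUnitL? x) 1)) * N₀
    countInClasses Q? = begin
      (∑[ k ∈ upTo M ] ind (isUnit? k) (ind (Q? (k % L)) 1))  ≡⟨ sumByClass Q? ⟩
      (∑[ x ∈ upTo L ] ind (Q? x) (classSize x))
        ≡⟨ sum-congᴬ (All.map (λ {x} x<L → cong (ind (Q? x)) (classSize-ind x x<L)) (upTo-< L)) ⟩
      (∑[ x ∈ upTo L ] ind (Q? x) (ind (isUnitL? x) N₀))
        ≡⟨ sum-cong (upTo L) (λ x → cong (ind (Q? x)) (sym (trans (ind-*ʳ (isUnitL? x) 1 N₀) (ind-cong (isUnitL? x) (*-identityˡ N₀))))) ⟩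
      (∑[ x ∈ upTo L ] ind (Q? x) (ind (isUnitL? x) 1 * N₀))
        ≡⟨ sum-cong (upTo L) (λ x → sym (ind-*ʳ (Q? x) _ N₀)) ⟩
      (∑[ x ∈ upTo L ] ind (Q? x) (ind (isUnitL? x) 1) * N₀)   ≡⟨ sum-*ʳ (upTo L) N₀ _ ⟨
      (∑[ x ∈ upTo L ] ind (Q? x) (ind (isUnitL? x) 1)) * N₀   ∎
      where open ≡-Reasoning

    -- with the trivial condition: φ(M) = φ(L) · N₀
    φ-factor : φ M ≡ φ L * N₀
    φ-factor = trans (φ≡unitCount M) (trans (countInClasses (λ _ → yes tt)) (cong (_* N₀) (sym (φ≡unitCount L))))

    φ-quotient : φ M div φ L ≡ N₀
    φ-quotient = trans (cong (_div φ L) φ-factor) (*-div (φ L) N₀ (φ≥1 L))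

    unitsSatisfying : ∀ {q} {C : ℕ → Set q} (C? : Decidable C) →
                      (∀ k → C k → C (k % L)) → (∀ k → C (k % L) → C k) →
                      length (filter C? (filter isUnit? (range1 M)))
                        ≡ (φ M div φ L) * length (filter (λ x → C? x ×-dec isUnitL? x) (upTo L))
    unitsSatisfying {C = C} C? down up = begin
      length (filter C? (filter isUnit? (range1 M)))          ≡⟨ count≡sum C? (filter isUnit? (range1 M)) ⟩
      (∑[ k ∈ filter isUnit? (range1 M) ] ind (C? k) 1)       ≡⟨ sum-filter isUnit? (range1 M) _ ⟩
      (∑[ k ∈ range1 M ] ind (isUnit? k) (ind (C? k) 1))      ≡⟨ sum-range1≡upTo M _ endpoint ⟩
      (∑[ k ∈ upTo M ] ind (isUnit? k) (ind (C? k) 1))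
        ≡⟨ sum-cong (upTo M) (λ k → cong (ind (isUnit? k)) (ind-⇔ (C? k) (C? (k % L)) (down k) (up k) 1)) ⟩
      (∑[ k ∈ upTo M ] ind (isUnit? k) (ind (C? (k % L)) 1))  ≡⟨ countInClasses C? ⟩
      (∑[ x ∈ upTo L ] ind (C? x) (ind (isUnitL? x) 1)) * N₀
        ≡⟨ cong (_* N₀) (sum-cong (upTo L) (λ x → ind-∧ (C? x) (isUnitL? x) (C? x ×-dec isUnitL? x) 1)) ⟩
      (∑[ x ∈ upTo L ] ind (C? x ×-dec isUnitL? x) 1) * N₀    ≡⟨ cong (_* N₀) (count≡sum _ (upTo L)) ⟨
      count * N₀                                              ≡⟨ *-comm count N₀ ⟩
      N₀ * count                                              ≡⟨ cong (_* count) φ-quotient ⟨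
      (φ M div φ L) * count                                   ∎
      where
      open ≡-Reasoning
      count = length (filter (λ x → C? x ×-dec isUnitL? x) (upTo L))
      M%L≡0 : M % L ≡ 0
      M%L≡0 = n∣m⇒m%n≡0 M L L∣M
      gcd[M,M]≡gcd[0,M] : gcd M M ≡ gcd 0 M
      gcd[M,M]≡gcd[0,M] = trans (gcd[n,n]≡n M) (sym (gcd-identityˡ M))
      endpoint : ind (isUnit? M) (ind (C? M) 1) ≡ ind (isUnit? 0) (ind (C? 0) 1)
      endpoint = ind²-⇔ (isUnit? M) (C? M) (isUnit? 0) (C? 0)
        (λ M⊥M cM → trans (sym gcd[M,M]≡gcd[0,M]) M⊥M , subst C M%L≡0 (down M cM))
        (λ 0⊥M c0 → trans gcd[M,M]≡gcd[0,M] 0⊥M , up M (subst C (sym M%L≡0) c0))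
        1

-- The values of μ used by Möbius inversion: μ(p·b) = 0 if p ∣ b, and
-- μ(p·b) = -μ(b) if p ∤ b (p prime, b ≥ 1). With μ(n) = (-1)^ω(n) for
-- squarefree n and 0 otherwise, this is: p·b is squarefree iff b is and p ∤ b,
-- in which case ω(p·b) = ω(b) + 1.
module MobiusValues where
  open import Data.Nat
  open import Data.Nat.Properties
  open import Data.Nat.Divisibility
  open import Data.Nat.Coprimality using (Coprime; coprime-divisor)
  open import Data.Nat.Primality using (Prime; prime?; euclidsLemma; prime⇒irreducible; prime⇒nonZero)
  open import Data.Integer as ℤ using (ℤ; +_)
  open import Data.Sum using (inj₁; inj₂; [_,_]′)
  open import Data.List.Membership.Propositional using (_∈_)
  open import Data.List.Membership.Propositional.Properties using (∈-upTo⁺; ∈-map⁺; ∈-map⁻; ∈-filter⁺; ∈-filter⁻)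
  open import Data.List.Relation.Unary.Any using (here; there)
  open import Relation.Binary.PropositionalEquality
  open Arithmetic
  open ListSums +-*-commutativeSemiring
  open NatCounting

  HasSquareFactor : ℕ → Set
  HasSquareFactor n = Σ ℕ (λ d → 2 ≤ d × d * d ∣ n)

  μ-squarefree : ∀ n → squareDivisorCount n ≡ 0 → μ n ≡ negOnePow (ω n)
  μ-squarefree n e with squareDivisorCount n
  ... | zero  = refl
  ... | suc _ = ⊥-elim (1+n≢0 e)

  μ-squareful : ∀ n → squareDivisorCount n ≢ 0 → μ n ≡ + 0
  μ-squareful n e with squareDivisorCount n
  ... | zero  = ⊥-elim (e refl)
  ... | suc _ = refl

  ∈⇒length≢0 : ∀ {x : ℕ} {xs} → x ∈ xs → length xs ≢ 0
  ∈⇒length≢0 (here _)  ()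
  ∈⇒length≢0 (there _) ()

  length≢0⇒∈ : ∀ {xs : List ℕ} → length xs ≢ 0 → Σ ℕ (_∈ xs)
  length≢0⇒∈ {[]}    h = ⊥-elim (h refl)
  length≢0⇒∈ {x ∷ _} _ = x , here refl

  squareFactor⇒count≢0 : ∀ {n} → 1 ≤ n → HasSquareFactor n → squareDivisorCount n ≢ 0
  squareFactor⇒count≢0 {n} 1≤n (d@(suc (suc k)) , _ , d²∣n) =
    ∈⇒length≢0 (∈-filter⁺ (λ d → (d * d) ∣? n) (∈-map⁺ (λ k → suc (suc k)) (∈-upTo⁺ k<n)) d²∣n)
    where
    k<n : k < n
    k<n = ≤-trans (n≤1+n (suc k)) (≤-trans (m≤m*n d d) (∣⇒≤ {{>-nonZero 1≤n}} d²∣n))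
  squareFactor⇒count≢0 _ (suc zero , s≤s () , _)

  count≢0⇒squareFactor : ∀ {n} → squareDivisorCount n ≢ 0 → HasSquareFactor n
  count≢0⇒squareFactor {n} count≢0 with length≢0⇒∈ count≢0
  ... | d , d∈ with ∈-filter⁻ (λ d → (d * d) ∣? n) {xs = List.map (λ k → suc (suc k)) (upTo n)} d∈
  ...   | d∈map , d²∣n with ∈-map⁻ (λ k → suc (suc k)) d∈map
  ...     | k , _ , refl = suc (suc k) , s≤s (s≤s z≤n) , d²∣n

  squarefree-* : ∀ {p b} → Prime p → ¬ p ∣ b → ¬ HasSquareFactor b → ¬ HasSquareFactor (p * b)
  squarefree-* {p} {b} pp p∤b b-sf (d , 2≤d , d²∣pb) with primeFactor d 2≤d
  ... | q , pq , q∣d with q²∣pb ← ∣-trans (*-pres-∣ q∣d q∣d) d²∣pb | q ≟ p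
  ...   | yes refl = p∤b (*-cancelˡ-∣ p {{prime⇒nonZero pp}} q²∣pb)
  ...   | no  q≢p  = b-sf (q , ≢0,1⇒≥2 q (λ q≡0 → <⇒≢ (prime≥1 pq) (sym q≡0)) (prime≢1 pq) ,
                           coprime-divisor (coprime-* q⊥p q⊥p) q²∣pb)
    where
    q⊥p : Coprime q p
    q⊥p = prime∤⇒coprime pq λ q∣p → [ prime≢1 pq , q≢p ]′ (prime⇒irreducible pp q∣p)

  -- the number of prime divisors of n in [1, N]; ω n is the case N = n
  primeDivisorsUpTo : ℕ → ℕ → ℕ
  primeDivisorsUpTo N n = ∑[ q ∈ range1 N ] ind (prime? q ×-dec q ∣? n) 1

  -- numbers beyond n do not divide n
  primeDivisorsUpTo-enough : ∀ n N → 1 ≤ n → n ≤ N → primeDivisorsUpTo N n ≡ primeDivisorsUpTo n n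
  primeDivisorsUpTo-enough n N 1≤n n≤N = sum-range1-truncate n N _ n≤N
    (λ q n<q → ind-no (prime? q ×-dec q ∣? n) (λ (_ , q∣n) → <⇒≱ n<q (∣⇒≤ {{>-nonZero 1≤n}} q∣n)) 1)

  primeDivisorsUpTo-* : ∀ {p b} → Prime p → ¬ p ∣ b → ∀ N →
                        primeDivisorsUpTo N (p * b) ≡ primeDivisorsUpTo N b + (∑[ q ∈ range1 N ] ind (q ≟ p) 1)
  primeDivisorsUpTo-* {p} {b} pp p∤b N = trans (sum-cong (range1 N) split) (sum-+ (range1 N) _ _)
    where
    split : ∀ q → ind (prime? q ×-dec q ∣? (p * b)) 1 ≡ ind (prime? q ×-dec q ∣? b) 1 + ind (q ≟ p) 1
    split q with prime? q ×-dec q ∣? (p * b) | prime? q ×-dec q ∣? b | q ≟ p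
    ... | yes _          | yes _             | no _     = refl
    ... | yes _          | no _              | yes _    = refl
    ... | no _           | no _              | no _     = refl
    ... | _              | yes (_ , q∣b)     | yes refl = ⊥-elim (p∤b q∣b)
    ... | no ¬q∣pb       | yes (pq , q∣b)    | no _     = ⊥-elim (¬q∣pb (pq , ∣n⇒∣m*n p q∣b))
    ... | no ¬q∣pb       | no _              | yes refl = ⊥-elim (¬q∣pb (pp , m∣m*n b))
    ... | yes (pq , q∣pb) | no ¬q∣b          | no q≢p with euclidsLemma p b pq q∣pb
    ...   | inj₂ q∣b = ⊥-elim (¬q∣b (pq , q∣b))
    ...   | inj₁ q∣p = ⊥-elim ([ prime≢1 pq , q≢p ]′ (prime⇒irreducible pp q∣p))

  ω-* : ∀ {p b} → Prime p → ¬ p ∣ b → 1 ≤ b → ω (p * b) ≡ suc (ω b)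
  ω-* {p} {b} pp p∤b 1≤b = begin
    ω (p * b)                                  ≡⟨ count≡sum (λ q → prime? q ×-dec q ∣? (p * b)) (range1 (p * b)) ⟩
    primeDivisorsUpTo (p * b) (p * b)          ≡⟨ primeDivisorsUpTo-* pp p∤b (p * b) ⟩
    primeDivisorsUpTo (p * b) b + (∑[ q ∈ range1 (p * b) ] ind (q ≟ p) 1)
      ≡⟨ cong₂ _+_ (primeDivisorsUpTo-enough b (p * b) 1≤b b≤pb) (sum-delta₁ (p * b) p (prime≥1 pp) p≤pb (λ _ → 1)) ⟩
    primeDivisorsUpTo b b + 1                  ≡⟨ +-comm _ 1 ⟩
    suc (primeDivisorsUpTo b b)                ≡⟨ cong suc (count≡sum (λ q → prime? q ×-dec q ∣? b) (range1 b)) ⟨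
    suc (ω b)                                  ∎
    where
    open ≡-Reasoning
    b≤pb : b ≤ p * b
    b≤pb = m≤n*m b p {{prime⇒nonZero pp}}
    p≤pb : p ≤ p * b
    p≤pb = m≤m*n p b {{>-nonZero 1≤b}}

  -- p·b has the square factor p² when p ∣ b
  μ-*-dividing : ∀ {p b} → Prime p → p ∣ b → 1 ≤ b → μ (p * b) ≡ + 0
  μ-*-dividing {p} {b} pp p∣b 1≤b = μ-squareful (p * b)
    (squareFactor⇒count≢0 (*-mono-≤ (prime≥1 pp) 1≤b) (p , ≢0,1⇒≥2 p (λ p≡0 → <⇒≢ (prime≥1 pp) (sym p≡0)) (prime≢1 pp) , *-monoʳ-∣ p p∣b))

  μ-*-coprime : ∀ {p b} → Prime p → ¬ p ∣ b → 1 ≤ b → μ (p * b) ≡ ℤ.- μ b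
  μ-*-coprime {p} {b} pp p∤b 1≤b with squareDivisorCount b ≟ 0
  ... | no b-squareful = trans (μ-squareful (p * b) pb-squareful) (cong ℤ.-_ (sym (μ-squareful b b-squareful)))
    where
    pb-squareful : squareDivisorCount (p * b) ≢ 0
    pb-squareful = let (d , 2≤d , d²∣b) = count≢0⇒squareFactor b-squareful in
      squareFactor⇒count≢0 (*-mono-≤ (prime≥1 pp) 1≤b) (d , 2≤d , ∣n⇒∣m*n p d²∣b)
  ... | yes b-squarefree = begin
    μ (p * b)                 ≡⟨ μ-squarefree (p * b) pb-squarefree ⟩
    negOnePow (ω (p * b))     ≡⟨ cong negOnePow (ω-* pp p∤b 1≤b) ⟩
    ℤ.- negOnePow (ω b)       ≡⟨ cong ℤ.-_ (μ-squarefree b b-squarefree) ⟨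
    ℤ.- μ b                   ∎
    where
    open ≡-Reasoning
    pb-squarefree : squareDivisorCount (p * b) ≡ 0
    pb-squarefree with squareDivisorCount (p * b) ≟ 0
    ... | yes e = e
    ... | no pb-squareful = ⊥-elim (squarefree-* pp p∤b
            (λ sq → squareFactor⇒count≢0 1≤b sq b-squarefree) (count≢0⇒squareFactor pb-squareful))

-- The key identity is
-- Σ_{a ∣ k} μ(a) = [k = 1], proved by pairing each divisor a with p ∤ a with
-- the divisor p·a, for a prime p ∣ k. It gives Σ_{d ∣ n} (μ * f)(d) = f(n), and
-- hence f(gcd(v, m)) = Σ_{d ∣ m, d ∣ v} (μ * f)(d), which expands each factor on
-- the left-hand side of the theorem.
module MobiusInversion {c ℓ} (R : CommutativeRing c ℓ) where
  open import Data.Nat.Divisibility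
  open import Data.Nat.GCD using (gcd; gcd[m,n]∣m; gcd[m,n]∣n; gcd-greatest; gcd[m,n]≢0)
  open import Data.Nat.Coprimality as Coprimality using (coprime-divisor)
  open import Data.Nat.Primality using (Prime; prime⇒nonZero)
  open import Data.Integer as ℤ using (ℤ; +_; -[1+_])
  open import Data.Sum using (inj₂)
  open CommutativeRing R
  open RingDefs R using (fromℤ; μ⋆)
  open import Algebra.Properties.Ring ring using (-0#≈0#; -‿involutive; -‿+-comm)
  open import Relation.Binary.Reasoning.Setoid setoid
  open ListSums commutativeSemiring
  open Arithmetic using (primeFactor; prime∤⇒coprime; prime≥1)
  open MobiusValues using (μ-*-dividing; μ-*-coprime)

  μR : ℕ → Carrier
  μR n = fromℤ (μ n)

  fromℤ-neg : ∀ z → fromℤ (ℤ.- z) ≈ - fromℤ z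
  fromℤ-neg (+ zero)  = sym -0#≈0#
  fromℤ-neg (+ suc n) = refl
  fromℤ-neg -[1+ n ]  = sym (-‿involutive _)

  sum-neg : ∀ {a} {A : Set a} (xs : List A) (F : A → Carrier) → (∑[ x ∈ xs ] - F x) ≈ - sumOver xs F
  sum-neg []       F = sym -0#≈0#
  sum-neg (x ∷ xs) F = trans (+-congˡ (sum-neg xs F)) (-‿+-comm _ _)

  ind-neg : ∀ {p} {Q : Set p} (d : Dec Q) x → ind d (- x) ≈ - ind d x
  ind-neg (yes _) x = refl
  ind-neg (no _)  x = sym -0#≈0#

  sum-multiples : ∀ p n → 1 ≤ p → (F : ℕ → Carrier) →
                  (∑[ a ∈ range1 (p ℕ.* n) ] ind (p ∣? a) (F a)) ≈ (∑[ b ∈ range1 n ] F (p ℕ.* b))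
  sum-multiples p n 1≤p F = begin
    (∑[ a ∈ range1 (p ℕ.* n) ] ind (p ∣? a) (F a))
      ≈⟨ sum-congᴬ (All.map (λ (1≤a , a≤pn) → asDelta _ 1≤a a≤pn) (range1-bounds (p ℕ.* n))) ⟩
    (∑[ a ∈ range1 (p ℕ.* n) ] (∑[ b ∈ range1 n ] ind (a ≟ p ℕ.* b) (F a)))  ≈⟨ sum-swap (range1 (p ℕ.* n)) (range1 n) _ ⟩
    (∑[ b ∈ range1 n ] (∑[ a ∈ range1 (p ℕ.* n) ] ind (a ≟ p ℕ.* b) (F a)))
      ≈⟨ sum-congᴬ (All.map (λ {b} (1≤b , b≤n) → sum-delta₁ (p ℕ.* n) (p ℕ.* b) (ℕP.*-mono-≤ 1≤p 1≤b) (ℕP.*-monoʳ-≤ p b≤n) F) (range1-bounds n)) ⟩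
    (∑[ b ∈ range1 n ] F (p ℕ.* b)) ∎
    where
    instance _ = ℕ.>-nonZero 1≤p
    asDelta : ∀ a → 1 ≤ a → a ≤ p ℕ.* n → ind (p ∣? a) (F a) ≈ (∑[ b ∈ range1 n ] ind (a ≟ p ℕ.* b) (F a))
    asDelta a 1≤a a≤pn with p ∣? a
    ... | no p∤a = sym (sum-zero (range1 n) (λ b → ind-no (a ≟ p ℕ.* b) (λ e → p∤a (divides b (≡.trans e (ℕP.*-comm p b)))) (F a)))
    ... | yes (divides q a≡qp) = sym (trans
          (sum-cong (range1 n) (λ b → ind-⇔ (a ≟ p ℕ.* b) (b ≟ q) a≡pb⇒b≡q (λ { ≡.refl → a≡pq }) (F a)))
          (sum-delta₁ n q 1≤q q≤n (λ _ → F a)))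
      where
      a≡pq : a ≡ p ℕ.* q
      a≡pq = ≡.trans a≡qp (ℕP.*-comm q p)
      a≡pb⇒b≡q : ∀ {b} → a ≡ p ℕ.* b → b ≡ q
      a≡pb⇒b≡q a≡pb = ℕP.*-cancelˡ-≡ _ q p (≡.trans (≡.sym a≡pb) a≡pq)
      1≤q : 1 ≤ q
      1≤q = ℕP.n≢0⇒n>0 (λ { ≡.refl → ℕP.<⇒≱ 1≤a (ℕP.≤-reflexive a≡qp) })
      q≤n : q ≤ n
      q≤n = ℕP.*-cancelˡ-≤ p (ℕP.≤-trans (ℕP.≤-reflexive (≡.sym a≡pq)) a≤pn)

  divisorSum-truncate : ∀ k N (G : ℕ → Carrier) → 1 ≤ k → k ≤ N →
                        (∑[ a ∈ range1 N ] ind (a ∣? k) (G a)) ≈ (∑[ a ∈ range1 k ] ind (a ∣? k) (G a))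
  divisorSum-truncate k N G 1≤k k≤N = sum-range1-truncate k N _ k≤N
    (λ a k<a → ind-no (a ∣? k) (λ a∣k → ℕP.<⇒≱ k<a (∣⇒≤ {{ℕ.>-nonZero 1≤k}} a∣k)) (G a))

  mobius-pairing : ∀ {p k} → Prime p → p ∣ k → ∀ b → 1 ≤ b →
                   ind (p ℕ.* b ∣? k) (μR (p ℕ.* b)) ≈ - ind (b ∣? k) (ind (¬? (p ∣? b)) (μR b))
  mobius-pairing {p} {k} pp (divides q k≡qp) b 1≤b with p ∣? b
  ... | yes p∣b = begin
    ind (p ℕ.* b ∣? k) (μR (p ℕ.* b))  ≈⟨ ind-cong (p ℕ.* b ∣? k) (reflexive (≡.cong fromℤ (μ-*-dividing pp p∣b 1≤b))) ⟩
    ind (p ℕ.* b ∣? k) 0#              ≈⟨ ind-zero (p ℕ.* b ∣? k) ⟩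
    0#                                 ≈⟨ -0#≈0# ⟨
    - 0#                               ≈⟨ -‿cong (ind-zero (b ∣? k)) ⟨
    - ind (b ∣? k) 0#                  ∎
  ... | no p∤b = begin
    ind (p ℕ.* b ∣? k) (μR (p ℕ.* b))  ≈⟨ ind-cong (p ℕ.* b ∣? k) (trans (reflexive (≡.cong fromℤ (μ-*-coprime pp p∤b 1≤b))) (fromℤ-neg (μ b))) ⟩
    ind (p ℕ.* b ∣? k) (- μR b)        ≈⟨ ind-neg (p ℕ.* b ∣? k) (μR b) ⟩
    - ind (p ℕ.* b ∣? k) (μR b)        ≈⟨ -‿cong (ind-⇔ (p ℕ.* b ∣? k) (b ∣? k) (∣-trans (n∣m*n p)) pb∣k (μR b)) ⟩
    - ind (b ∣? k) (μR b)              ∎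
    where
    -- p and b are coprime divisors of k, so p·b ∣ k
    pb∣k : b ∣ k → p ℕ.* b ∣ k
    pb∣k b∣k = ≡.subst (p ℕ.* b ∣_) (≡.sym k≡pq) (*-monoʳ-∣ p
      (coprime-divisor (Coprimality.sym (prime∤⇒coprime pp p∤b)) (≡.subst (b ∣_) k≡pq b∣k)))
      where
      k≡pq : k ≡ p ℕ.* q
      k≡pq = ≡.trans k≡qp (ℕP.*-comm q p)

  mobiusSum : ∀ k → 1 ≤ k → (∑[ a ∈ range1 k ] ind (a ∣? k) (μR a)) ≈ ind (k ≟ 1) 1#
  mobiusSum (suc zero) _ = trans (+-identityʳ _) (trans (ind-yes (1 ∣? 1) ∣-refl (μR 1)) (+-identityʳ 1#))
  mobiusSum k@(suc (suc _)) _ with primeFactor k (s≤s (s≤s z≤n))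
  ... | p , pp , p∣k = begin
    (∑[ a ∈ range1 k ] ind (a ∣? k) (μR a))        ≈⟨ divisorSum-truncate k (p ℕ.* k) μR (s≤s z≤n) k≤pk ⟨
    (∑[ a ∈ range1 (p ℕ.* k) ] ind (a ∣? k) (μR a))  ≈⟨ sum-split (p ∣?_) (range1 (p ℕ.* k)) _ ⟩
    (∑[ a ∈ range1 (p ℕ.* k) ] ind (¬? (p ∣? a)) (ind (a ∣? k) (μR a)))
      + (∑[ a ∈ range1 (p ℕ.* k) ] ind (p ∣? a) (ind (a ∣? k) (μR a)))
      ≈⟨ +-cong (trans (sum-cong (range1 (p ℕ.* k)) (λ a → ind-comm (¬? (p ∣? a)) (a ∣? k) (μR a)))
                       (divisorSum-truncate k (p ℕ.* k) _ (s≤s z≤n) k≤pk))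
                (sum-multiples p k (prime≥1 pp) (λ a → ind (a ∣? k) (μR a))) ⟩
    X + (∑[ b ∈ range1 k ] ind (p ℕ.* b ∣? k) (μR (p ℕ.* b)))
      ≈⟨ +-congˡ (trans (sum-congᴬ (All.map (λ (1≤b , _) → mobius-pairing pp p∣k _ 1≤b) (range1-bounds k))) (sum-neg (range1 k) _)) ⟩
    X + - X                                      ≈⟨ -‿inverseʳ X ⟩
    0#                                           ≈⟨ ind-no (k ≟ 1) (λ ()) 1# ⟨
    ind (k ≟ 1) 1#                               ∎
    where
    instance _ = prime⇒nonZero pp
    k≤pk : k ℕ.≤ p ℕ.* k
    k≤pk = ℕP.m≤n*m k p
    X : Carrier
    X = ∑[ a ∈ range1 k ] ind (a ∣? k) (ind (¬? (p ∣? a)) (μR a))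
  -- Σ_{a ∈ [1, N]} [a·b ∣ n] μ(a) = [b = n] for 1 ≤ n ≤ N: if n = k·b it is
  -- Σ_{a ∣ k} μ(a) = [k = 1]
  mobiusSum-scaled : ∀ N n b → 1 ≤ n → n ≤ N → 1 ≤ b → (∑[ a ∈ range1 N ] ind (a ℕ.* b ∣? n) (μR a)) ≈ ind (b ≟ n) 1#
  mobiusSum-scaled N n b 1≤n n≤N 1≤b with b ∣? n
  ... | no b∤n = trans (sum-zero (range1 N) (λ a → ind-no (a ℕ.* b ∣? n) (λ ab∣n → b∤n (∣-trans (n∣m*n a) ab∣n)) (μR a)))
                       (sym (ind-no (b ≟ n) (λ { ≡.refl → b∤n ∣-refl }) 1#))
  ... | yes (divides k n≡kb) = begin
    (∑[ a ∈ range1 N ] ind (a ℕ.* b ∣? n) (μR a))  ≈⟨ sum-cong (range1 N) (λ a → ind-⇔ (a ℕ.* b ∣? n) (a ∣? k) ab∣n⇒a∣k a∣k⇒ab∣n (μR a)) ⟩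
    (∑[ a ∈ range1 N ] ind (a ∣? k) (μR a))        ≈⟨ divisorSum-truncate k N μR 1≤k (ℕP.≤-trans k≤n n≤N) ⟩
    (∑[ a ∈ range1 k ] ind (a ∣? k) (μR a))        ≈⟨ mobiusSum k 1≤k ⟩
    ind (k ≟ 1) 1#                                 ≈⟨ ind-⇔ (k ≟ 1) (b ≟ n) k≡1⇒b≡n b≡n⇒k≡1 1# ⟩
    ind (b ≟ n) 1#                                 ∎
    where
    instance _ = ℕ.>-nonZero 1≤b
    ab∣n⇒a∣k : ∀ {a} → a ℕ.* b ∣ n → a ∣ k
    ab∣n⇒a∣k ab∣n = *-cancelʳ-∣ b (≡.subst (_ ∣_) n≡kb ab∣n)
    a∣k⇒ab∣n : ∀ {a} → a ∣ k → a ℕ.* b ∣ n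
    a∣k⇒ab∣n a∣k = ≡.subst (_ ∣_) (≡.sym n≡kb) (*-monoˡ-∣ b a∣k)
    1≤k : 1 ≤ k
    1≤k = ℕP.n≢0⇒n>0 (λ { ≡.refl → ℕP.<⇒≱ 1≤n (ℕP.≤-reflexive n≡kb) })
    k≤n : k ≤ n
    k≤n = ℕP.≤-trans (ℕP.m≤m*n k b) (ℕP.≤-reflexive (≡.sym n≡kb))
    k≡1⇒b≡n : k ≡ 1 → b ≡ n
    k≡1⇒b≡n ≡.refl = ≡.sym (≡.trans n≡kb (ℕP.*-identityˡ b))
    b≡n⇒k≡1 : b ≡ n → k ≡ 1
    b≡n⇒k≡1 ≡.refl = ℕP.*-cancelʳ-≡ k 1 b (≡.trans (≡.sym n≡kb) (≡.sym (ℕP.*-identityˡ b)))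

  convolutionUpTo : (ℕ → Carrier) → ℕ → ℕ → Carrier
  convolutionUpTo f N d = ∑[ a ∈ range1 N ] (∑[ b ∈ range1 N ] ind (a ℕ.* b ≟ d) (μR a * f b))

  μ⋆≈convolutionUpTo : ∀ f d N → d ≤ N → μ⋆ f d ≈ convolutionUpTo f N d
  μ⋆≈convolutionUpTo f d N d≤N = begin
    μ⋆ f d   ≈⟨ sum-filter (λ ab → proj₁ ab ℕ.* proj₂ ab ≟ d) (List.cartesianProduct (range1 d) (range1 d)) _ ⟩
    _        ≈⟨ sum-cartesianProduct (range1 d) (range1 d) _ ⟩
    convolutionUpTo f d d  ≈⟨ truncate ⟨
    convolutionUpTo f N d  ∎
    where
    -- terms with a > d or b > d vanish since a·b ≥ a, b
    truncate : convolutionUpTo f N d ≈ convolutionUpTo f d d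
    truncate = trans
      (sum-congᴬ (All.map (λ {a} (1≤a , _) → sum-range1-truncate d N _ d≤N (λ b d<b →
        ind-no (a ℕ.* b ≟ d) (λ ab≡d → ℕP.<⇒≱ d<b (ℕP.≤-trans (ℕP.m≤n*m b a {{ℕ.>-nonZero 1≤a}}) (ℕP.≤-reflexive ab≡d))) _))
        (range1-bounds N)))
      (sum-range1-truncate d N _ d≤N (λ a d<a → sum-zeroᴬ (All.map (λ {b} (1≤b , _) →
        ind-no (a ℕ.* b ≟ d) (λ ab≡d → ℕP.<⇒≱ d<a (ℕP.≤-trans (ℕP.m≤m*n a b {{ℕ.>-nonZero 1≤b}}) (ℕP.≤-reflexive ab≡d))) _)
        (range1-bounds d))))

  sum-divisorDelta : ∀ N n a b → 1 ≤ n → n ≤ N → 1 ≤ a → 1 ≤ b → (X : Carrier) →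
                     (∑[ d ∈ range1 N ] ind (d ∣? n) (ind (a ℕ.* b ≟ d) X)) ≈ ind (a ℕ.* b ∣? n) X
  sum-divisorDelta N n a b 1≤n n≤N 1≤a 1≤b X = trans
    (sum-cong (range1 N) (λ d → ind²-⇔ (d ∣? n) (a ℕ.* b ≟ d) (d ≟ a ℕ.* b) (a ℕ.* b ∣? n)
      (λ d∣n ab≡d → ≡.sym ab≡d , ≡.subst (_∣ n) (≡.sym ab≡d) d∣n) (λ d≡ab ab∣n → ≡.subst (_∣ n) (≡.sym d≡ab) ab∣n , ≡.sym d≡ab) X))
    delta
    where
    delta : (∑[ d ∈ range1 N ] ind (d ≟ a ℕ.* b) (ind (a ℕ.* b ∣? n) X)) ≈ ind (a ℕ.* b ∣? n) X
    delta with a ℕ.* b ℕ.≤? N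
    ... | yes ab≤N = sum-delta₁ N (a ℕ.* b) (ℕP.*-mono-≤ 1≤a 1≤b) ab≤N _
    ... | no  ab≰N = trans (sum-zeroᴬ (All.map (λ {d} (_ , d≤N) → ind-no (d ≟ a ℕ.* b) (λ { ≡.refl → ab≰N d≤N }) _) (range1-bounds N)))
                           (sym (ind-no (a ℕ.* b ∣? n) (λ ab∣n → ab≰N (ℕP.≤-trans (∣⇒≤ {{ℕ.>-nonZero 1≤n}} ab∣n) n≤N)) X))

  mobiusInversion : ∀ f n N → 1 ≤ n → n ≤ N → (∑[ d ∈ range1 N ] ind (d ∣? n) (μ⋆ f d)) ≈ f n
  mobiusInversion f n N 1≤n n≤N = begin
    (∑[ d ∈ range1 N ] ind (d ∣? n) (μ⋆ f d))
      ≈⟨ sum-congᴬ (All.map (λ {d} (_ , d≤N) → ind-cong (d ∣? n) (μ⋆≈convolutionUpTo f d N d≤N)) (range1-bounds N)) ⟩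
    (∑[ d ∈ range1 N ] ind (d ∣? n) (convolutionUpTo f N d))
      ≈⟨ sum-cong (range1 N) (λ d → trans (ind-sum (d ∣? n) (range1 N) _) (sum-cong (range1 N) (λ a → ind-sum (d ∣? n) (range1 N) _))) ⟩
    (∑[ d ∈ range1 N ] (∑[ a ∈ range1 N ] (∑[ b ∈ range1 N ] ind (d ∣? n) (ind (a ℕ.* b ≟ d) (μR a * f b)))))
      ≈⟨ trans (sum-swap (range1 N) (range1 N) _) (sum-cong (range1 N) (λ a → sum-swap (range1 N) (range1 N) _)) ⟩
    (∑[ a ∈ range1 N ] (∑[ b ∈ range1 N ] (∑[ d ∈ range1 N ] ind (d ∣? n) (ind (a ℕ.* b ≟ d) (μR a * f b)))))
      ≈⟨ sum-congᴬ (All.map (λ {a} (1≤a , _) → sum-congᴬ (All.map (λ {b} (1≤b , _) →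
           sum-divisorDelta N n a b 1≤n n≤N 1≤a 1≤b _) (range1-bounds N))) (range1-bounds N)) ⟩
    (∑[ a ∈ range1 N ] (∑[ b ∈ range1 N ] ind (a ℕ.* b ∣? n) (μR a * f b)))  ≈⟨ sum-swap (range1 N) (range1 N) _ ⟩
    (∑[ b ∈ range1 N ] (∑[ a ∈ range1 N ] ind (a ℕ.* b ∣? n) (μR a * f b)))
      ≈⟨ sum-cong (range1 N) (λ b → trans (sum-*ˡ (range1 N) (f b) _) (sum-cong (range1 N) (λ a → factor a b))) ⟨
    (∑[ b ∈ range1 N ] f b * (∑[ a ∈ range1 N ] ind (a ℕ.* b ∣? n) (μR a)))
      ≈⟨ sum-congᴬ (All.map (λ {b} (1≤b , _) → *-congˡ (mobiusSum-scaled N n b 1≤n n≤N 1≤b)) (range1-bounds N)) ⟩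
    (∑[ b ∈ range1 N ] f b * ind (b ≟ n) 1#)
      ≈⟨ sum-cong (range1 N) (λ b → trans (ind-*ˡ (b ≟ n) (f b) 1#) (ind-cong (b ≟ n) (*-identityʳ (f b)))) ⟩
    (∑[ b ∈ range1 N ] ind (b ≟ n) (f b))     ≈⟨ sum-delta₁ N n 1≤n n≤N f ⟩
    f n                                        ∎
    where
    factor : ∀ a b → f b * ind (a ℕ.* b ∣? n) (μR a) ≈ ind (a ℕ.* b ∣? n) (μR a * f b)
    factor a b = trans (ind-*ˡ (a ℕ.* b ∣? n) (f b) (μR a)) (ind-cong (a ℕ.* b ∣? n) (*-comm (f b) (μR a)))

  -- f(gcd(v, m)) = Σ_{d ∣ m, d ∣ v} (μ * f)(d): the divisors of m dividing v are
  -- exactly the divisors of gcd(v, m)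
  gcdInversion : ∀ m v → 1 ≤ m → (f : ℕ → Carrier) → f (gcd v m) ≈ (∑[ d ∈ divisors m ] ind (d ∣? v) (μ⋆ f d))
  gcdInversion m v 1≤m f = sym (begin
    (∑[ d ∈ divisors m ] ind (d ∣? v) (μ⋆ f d))                   ≈⟨ sum-filter (_∣? m) (range1 m) _ ⟩
    (∑[ d ∈ range1 m ] ind (d ∣? m) (ind (d ∣? v) (μ⋆ f d)))
      ≈⟨ sum-cong (range1 m) (λ d → trans (ind-∧ (d ∣? m) (d ∣? v) (d ∣? m ×-dec d ∣? v) _)
           (ind-⇔ (d ∣? m ×-dec d ∣? v) (d ∣? n) (λ (d∣m , d∣v) → gcd-greatest d∣v d∣m)
                  (λ d∣n → ∣-trans d∣n (gcd[m,n]∣n v m) , ∣-trans d∣n (gcd[m,n]∣m v m)) _)) ⟩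
    (∑[ d ∈ range1 m ] ind (d ∣? n) (μ⋆ f d))                     ≈⟨ mobiusInversion f n m 1≤n n≤m ⟩
    f n                                                           ∎)
    where
    n = gcd v m
    n≤m : n ≤ m
    n≤m = ∣⇒≤ {{ℕ.>-nonZero 1≤m}} (gcd[m,n]∣n v m)
    1≤n : 1 ≤ n
    1≤n = ℕP.n≢0⇒n>0 (gcd[m,n]≢0 v m (inj₂ (λ { ≡.refl → ℕP.<⇒≱ 1≤m z≤n })))

-- Integer polynomials respect congruences: x - y divides g(x) - g(y). Hence,
-- for d ∣ L, the condition d ∣ g(k) only depends on k mod L.
module PolynomialCongruence where
  open import Data.Nat.DivMod using (_%_; _/_; m≡m%n+[m/n]*n)
  open import Data.Nat.Divisibility using (n∣m*n)
  open import Data.Integer using (ℤ; +_; _+_; _*_; _-_; ∣_∣)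
  import Data.Integer.Properties as ℤP
  open import Data.Integer.Divisibility.Signed as ℤD using (∣ᵤ⇒∣; ∣⇒∣ᵤ; ∣m∣n⇒∣m+n; ∣m∣n⇒∣m-n; ∣m⇒∣m*n)
  open import Data.Integer.Tactic.RingSolver using (solve-∀)
  open import Relation.Binary.PropositionalEquality

  -- (g(x) - g(y)) / (x - y), computed along Horner's scheme
  differenceQuotient : Poly → ℤ → ℤ → ℤ
  differenceQuotient []       x y = + 0
  differenceQuotient (a ∷ as) x y = eval as x + y * differenceQuotient as x y

  eval-difference : ∀ g x y → eval g y ≡ eval g x - (x - y) * differenceQuotient g x y
  eval-difference []       x y = solve-∀′ x y
    where
    solve-∀′ : ∀ x y → + 0 ≡ + 0 - (x - y) * + 0
    solve-∀′ = solve-∀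
  eval-difference (a ∷ as) x y rewrite eval-difference as x y = horner a x y (eval as x) (differenceQuotient as x y)
    where
    horner : ∀ a x y E q → a + y * (E - (x - y) * q) ≡ (a + x * E) - (x - y) * (E + y * q)
    horner = solve-∀

  ∣-eval-transfer : ∀ g {x y d} → d ℤD.∣ x - y → d ℤD.∣ eval g x → d ℤD.∣ eval g y
  ∣-eval-transfer g {x} {y} d∣x-y d∣gx = subst (_ ℤD.∣_) (sym (eval-difference g x y))
    (∣m∣n⇒∣m-n d∣gx (∣m⇒∣m*n (differenceQuotient g x y) d∣x-y))

  ∣-eval-transfer⁻ : ∀ g {x y d} → d ℤD.∣ x - y → d ℤD.∣ eval g y → d ℤD.∣ eval g x
  ∣-eval-transfer⁻ g {x} {y} d∣x-y d∣gy = subst (_ ℤD.∣_) (cancel (eval g x) ((x - y) * differenceQuotient g x y))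
    (∣m∣n⇒∣m+n (subst (_ ℤD.∣_) (eval-difference g x y) d∣gy) (∣m⇒∣m*n (differenceQuotient g x y) d∣x-y))
    where
    cancel : ∀ a w → (a - w) + w ≡ a
    cancel = solve-∀

  L∣k-k%L : ∀ k L .{{_ : NonZero L}} → + L ℤD.∣ + k - + (k % L)
  L∣k-k%L k L = subst (+ L ℤD.∣_) qL≡k-r (∣ᵤ⇒∣ (n∣m*n (k / L)))
    where
    r = k % L
    qL = k / L ℕ.* L
    cancel : ∀ a b → b ≡ (a + b) - a
    cancel = solve-∀
    qL≡k-r : + qL ≡ + k - + r
    qL≡k-r = trans (cancel (+ r) (+ qL))
      (cong (_- + r) (trans (sym (ℤP.pos-+ r qL)) (cong +_ (sym (m≡m%n+[m/n]*n k L)))))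

  ∣-eval-mod : ∀ g k L d .{{_ : NonZero L}} → d ∣ L →
               (d ∣ ∣ eval g (+ k) ∣ → d ∣ ∣ eval g (+ (k % L)) ∣) ×
               (d ∣ ∣ eval g (+ (k % L)) ∣ → d ∣ ∣ eval g (+ k) ∣)
  ∣-eval-mod g k L d d∣L = (λ h → ∣⇒∣ᵤ (∣-eval-transfer g d∣k-k%L (∣ᵤ⇒∣ h)))
                         , (λ h → ∣⇒∣ᵤ (∣-eval-transfer⁻ g d∣k-k%L (∣ᵤ⇒∣ h)))
    where
    d∣k-k%L : + d ℤD.∣ + k - + (k % L)
    d∣k-k%L = ℤD.∣-trans (∣ᵤ⇒∣ d∣L) (L∣k-k%L k L)

module DivisorTuples where
  open import Data.Nat.DivMod using (_%_)
  open import Data.Nat.Divisibility using (_∣_; _∣?_; ∣-refl; ∣-trans)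
  open import Data.Nat.GCD using (gcd; gcd-zeroʳ)
  open import Data.Nat.LCM using (lcm-least; m∣lcm[m,n]; n∣lcm[m,n])
  open import Data.Nat.Coprimality using (coprime⇒gcd≡1; gcd≡1⇒coprime)
  open import Data.Integer using (+_; ∣_∣)
  open import Data.Unit using (⊤; tt)
  open import Data.Vec as Vec using (Vec; []; _∷_)
  open import Data.Vec.Relation.Unary.All using ([]; _∷_)
  open import Relation.Binary.PropositionalEquality
  open Arithmetic using (coprime-lcm; coprime-lcm⁻ˡ; coprime-lcm⁻ʳ)
  open PolynomialCongruence using (∣-eval-mod)

  DividesValues : ∀ {r} → Vec Poly r → Vec ℕ r → ℕ → Set
  DividesValues []       []       k = ⊤
  DividesValues (g ∷ G) (d ∷ ds) k = d ∣ ∣ eval g (+ k) ∣ × DividesValues G ds k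

  dividesValues? : ∀ {r} (G : Vec Poly r) (d : Vec ℕ r) k → Dec (DividesValues G d k)
  dividesValues? []       []       k = yes tt
  dividesValues? (g ∷ G) (d ∷ ds) k = (d ∣? ∣ eval g (+ k) ∣) ×-dec dividesValues? G ds k

  DividesEach : ∀ {r} → Vec ℕ r → Vec ℕ r → Set
  DividesEach []       []       = ⊤
  DividesEach (d ∷ ds) (m ∷ ms) = d ∣ m × DividesEach ds ms

  divisorTuples-divide : ∀ {r} (m : Vec ℕ r) → All.All (λ d → DividesEach d m) (divisorTuples m)
  divisorTuples-divide []       = tt ∷ []
  divisorTuples-divide (m ∷ ms) = AllP.concat⁺ (AllP.map⁺ (All.map
    (λ d∣m → AllP.map⁺ (All.map (d∣m ,_) (divisorTuples-divide ms)))
    (AllP.all-filter (_∣? m) (range1 m))))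

  lcmV-mono : ∀ {r} (d m : Vec ℕ r) → DividesEach d m → lcmV d ∣ lcmV m
  lcmV-mono []       []       _           = ∣-refl
  lcmV-mono (d ∷ ds) (m ∷ ms) (d∣m , dsm) =
    lcm-least (∣-trans d∣m (m∣lcm[m,n] m (lcmV ms))) (∣-trans (lcmV-mono ds ms dsm) (n∣lcm[m,n] m (lcmV ms)))

  dividesValues-mod : ∀ {r} (G : Vec Poly r) (d : Vec ℕ r) L .{{_ : NonZero L}} → lcmV d ∣ L → ∀ k →
                      (DividesValues G d k → DividesValues G d (k % L)) × (DividesValues G d (k % L) → DividesValues G d k)
  dividesValues-mod []       []       L _      k = (λ _ → tt) , (λ _ → tt)
  dividesValues-mod (g ∷ G) (d ∷ ds) L lcm∣L k =
    (λ (a , b) → proj₁ head a , proj₁ tail b) , (λ (a , b) → proj₂ head a , proj₂ tail b)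
    where
    head = ∣-eval-mod g k L d (∣-trans (m∣lcm[m,n] d (lcmV ds)) lcm∣L)
    tail = dividesValues-mod G ds L (∣-trans (n∣lcm[m,n] d (lcmV ds)) lcm∣L) k

  etaCond⇒ : ∀ {r} (G : Vec Poly r) (d : Vec ℕ r) x → EtaCond G d x → DividesValues G d x × gcd x (lcmV d) ≡ 1
  etaCond⇒ []       []       x []                    = tt , gcd-zeroʳ x
  etaCond⇒ (g ∷ G) (d ∷ ds) x ((d∣gx , x⊥d) ∷ rest) =
    let (divs , x⊥ds) = etaCond⇒ G ds x rest in
    (d∣gx , divs) , coprime⇒gcd≡1 (coprime-lcm {x} {d} {lcmV ds} (gcd≡1⇒coprime x⊥d) (gcd≡1⇒coprime x⊥ds))

  ⇒etaCond : ∀ {r} (G : Vec Poly r) (d : Vec ℕ r) x → DividesValues G d x × gcd x (lcmV d) ≡ 1 → EtaCond G d x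
  ⇒etaCond []       []       x _                     = []
  ⇒etaCond (g ∷ G) (d ∷ ds) x ((d∣gx , divs) , x⊥L) =
    (d∣gx , coprime⇒gcd≡1 (coprime-lcm⁻ˡ {x} {d} {lcmV ds} (gcd≡1⇒coprime x⊥L)))
    ∷ ⇒etaCond G ds x (divs , coprime⇒gcd≡1 (coprime-lcm⁻ʳ {x} {d} {lcmV ds} (gcd≡1⇒coprime x⊥L)))

module MainIdentity {c ℓ} (R : CommutativeRing c ℓ) where
  open import Data.Nat.Divisibility using (_∣_; _∣?_; ∣-refl; ∣-trans; 0∣⇒≡0)
  open import Data.Nat.GCD using (gcd)
  open import Data.Integer as ℤ using (∣_∣)
  open import Data.Vec as Vec using (Vec; []; _∷_)
  open import Data.Vec.Relation.Unary.All using ([]; _∷_)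
  open CommutativeRing R
  open RingDefs R using (prodV; μ⋆) renaming (_·_ to _·ᴿ_)
  open import Algebra.Properties.Semiring.Mult semiring using (×-assoc-*; ×-assocˡ; ×-congʳ) renaming (_×_ to _·_)
  open import Relation.Binary.Reasoning.Setoid setoid
  open ListSums commutativeSemiring
  open MobiusInversion R using (gcdInversion)
  open DivisorTuples
  open UnitsInResidueClasses using (unitsSatisfying)
  open NatCounting using (count-⇔)

  mobiusProduct : ∀ {r} → Vec (ℕ → Carrier) r → Vec ℕ r → Carrier
  mobiusProduct f d = prodV (Vec.zipWith μ⋆ f d)

  gcdProduct : ∀ {r} → Vec (ℕ → Carrier) r → Vec Poly r → Vec ℕ r → ℕ → Carrier
  gcdProduct f G m k = prodV (Vec.zipWith (λ fi gm → fi (gcd ∣ eval (proj₁ gm) (ℤ.+ k) ∣ (proj₂ gm))) f (Vec.zip G m))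

  productExpansion : ∀ {r} (f : Vec (ℕ → Carrier) r) (G : Vec Poly r) (m : Vec ℕ r) → All (1 ≤_) m → ∀ k →
                     gcdProduct f G m k ≈ (∑[ d ∈ divisorTuples m ] ind (dividesValues? G d k) (mobiusProduct f d))
  productExpansion []        []       []        []           k = sym (+-identityʳ 1#)
  productExpansion (fi ∷ fs) (g ∷ Gs) (mi ∷ ms) (1≤mi ∷ ps) k = begin
    fi (gcd v mi) * gcdProduct fs Gs ms k
      ≈⟨ *-cong (gcdInversion mi v 1≤mi fi) (productExpansion fs Gs ms ps k) ⟩
    (∑[ d ∈ divisors mi ] ind (d ∣? v) (μ⋆ fi d)) * (∑[ t ∈ divisorTuples ms ] ind (dividesValues? Gs t k) (mobiusProduct fs t))
      ≈⟨ trans (sum-*ʳ (divisors mi) _ _) (sum-cong (divisors mi) (λ d → sum-*ˡ (divisorTuples ms) _ _)) ⟩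
    (∑[ d ∈ divisors mi ] (∑[ t ∈ divisorTuples ms ] ind (d ∣? v) (μ⋆ fi d) * ind (dividesValues? Gs t k) (mobiusProduct fs t)))
      ≈⟨ sum-cong (divisors mi) (λ d → sum-cong (divisorTuples ms) (λ t → ind-product (d ∣? v) (dividesValues? Gs t k) _ _)) ⟩
    (∑[ d ∈ divisors mi ] (∑[ t ∈ divisorTuples ms ] ind (dividesValues? (g ∷ Gs) (d ∷ t) k) (mobiusProduct (fi ∷ fs) (d ∷ t))))
      ≈⟨ sum-cong (divisors mi) (λ d → reflexive (≡.sym (sum-map (d ∷_) (divisorTuples ms) _))) ⟩
    (∑[ d ∈ divisors mi ] sumOver (List.map (d ∷_) (divisorTuples ms)) (λ t → ind (dividesValues? (g ∷ Gs) t k) (mobiusProduct (fi ∷ fs) t)))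
      ≈⟨ sum-concatMap (λ d → List.map (d ∷_) (divisorTuples ms)) (divisors mi) _ ⟨
    (∑[ d ∈ divisorTuples (mi ∷ ms) ] ind (dividesValues? (g ∷ Gs) d k) (mobiusProduct (fi ∷ fs) d)) ∎
    where
    v = ∣ eval g (ℤ.+ k) ∣

  -- the scalar multiple n · x of the statement is the library's
  ·ᴿ≡· : ∀ n x → n ·ᴿ x ≡ n · x
  ·ᴿ≡· zero    x = ≡.refl
  ·ᴿ≡· (suc n) x = ≡.cong (x +_) (·ᴿ≡· n x)

  tupleContribution : ∀ {r} (m : Vec ℕ r) M .{{_ : NonZero M}} → lcmV m ∣ M →
                      (f : Vec (ℕ → Carrier) r) (G : Vec Poly r) (d : Vec ℕ r) → DividesEach d m →
                      (∑[ k ∈ filter (λ k → gcd k M ≟ 1) (range1 M) ] ind (dividesValues? G d k) (mobiusProduct f d))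
                        ≈ ((φ M div φ (lcmV d)) ·ᴿ mobiusProduct f d) * (η G d ·ᴿ 1#)
  tupleContribution m M lcm∣M f G d d∣m = begin
    (∑[ k ∈ units ] ind (C? k) P)           ≈⟨ sum-cong units (λ k → trans (ind-*ʳ (C? k) 1# P) (ind-cong (C? k) (*-identityˡ P))) ⟨
    (∑[ k ∈ units ] ind (C? k) 1# * P)      ≈⟨ sum-*ʳ units P _ ⟨
    (∑[ k ∈ units ] ind (C? k) 1#) * P      ≈⟨ *-congʳ (count-sum C? units) ⟨
    (length (filter C? units) · 1#) * P     ≡⟨ ≡.cong (λ n → (n · 1#) * P) count ⟩
    ((q ℕ.* e) · 1#) * P                    ≈⟨ *-congʳ (×-assocˡ 1# q e) ⟨
    (q · (e · 1#)) * P                      ≈⟨ ×-assoc-* q (e · 1#) P ⟩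
    q · ((e · 1#) * P)                      ≈⟨ ×-congʳ q (*-comm _ _) ⟩
    q · (P * (e · 1#))                      ≈⟨ ×-assoc-* q P (e · 1#) ⟨
    (q · P) * (e · 1#)                      ≡⟨ ≡.cong₂ _*_ (·ᴿ≡· q P) (·ᴿ≡· e 1#) ⟨
    (q ·ᴿ P) * (e ·ᴿ 1#)                    ∎
    where
    units = filter (λ k → gcd k M ≟ 1) (range1 M)
    C? = dividesValues? G d
    P = mobiusProduct f d
    L = lcmV d
    L∣M : L ∣ M
    L∣M = ∣-trans (lcmV-mono d m d∣m) lcm∣M
    instance
      L≢0 : NonZero L
      L≢0 = ℕ.≢-nonZero (λ L≡0 → ℕ.≢-nonZero⁻¹ M (0∣⇒≡0 (≡.subst (_∣ M) L≡0 L∣M)))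
    q = φ M div φ L
    e = η G d
    count : length (filter C? units) ≡ q ℕ.* e
    count = ≡.trans (unitsSatisfying M L L∣M C? (λ k → proj₁ (dividesValues-mod G d L ∣-refl k)) (λ k → proj₂ (dividesValues-mod G d L ∣-refl k)))
      (≡.cong (q ℕ.*_) (count-⇔ (λ x → C? x ×-dec (gcd x L ≟ 1)) (etaCond? G d) (⇒etaCond G d) (etaCond⇒ G d) (upTo L)))

theorem2 : ∀ {c ℓ} (R : CommutativeRing c ℓ) (r : ℕ) → 1 ≤ r →
    (m : Vec ℕ r) → All (λ mi → 1 ≤ mi) m →
    (M : ℕ) → 1 ≤ M → lcmV m ∣ M →
    (f : Vec (ℕ → CommutativeRing.Carrier R) r) (G : Vec Poly r) →
    CommutativeRing._≈_ R (RingDefs.LHS R m M f G) (RingDefs.RHS R m M f G)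
theorem2 R r _ m m≥1 M 1≤M lcm∣M f G = begin
  LHS m M f G
    ≈⟨ sum-cong units (productExpansion f G m m≥1) ⟩
  (∑[ k ∈ units ] (∑[ d ∈ divisorTuples m ] ind (dividesValues? G d k) (mobiusProduct f d)))
    ≈⟨ sum-swap units (divisorTuples m) _ ⟩
  (∑[ d ∈ divisorTuples m ] (∑[ k ∈ units ] ind (dividesValues? G d k) (mobiusProduct f d)))
    ≈⟨ sum-congᴬ (All.map (λ {d} → tupleContribution m M lcm∣M f G d) (divisorTuples-divide m)) ⟩
  RHS m M f G ∎
  where
  open CommutativeRing R using (setoid)
  open RingDefs R using (LHS; RHS)
  open ListSums (CommutativeRing.commutativeSemiring R)
  open MainIdentity R
  open DivisorTuples using (dividesValues?; divisorTuples-divide)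
  open import Data.Nat.GCD using (gcd)
  open import Relation.Binary.Reasoning.Setoid setoid
  instance _ = ℕ.>-nonZero 1≤M
  units = filter (λ k → gcd k M ≟ 1) (range1 M)
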